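{- Let $\mathcal{P}$ be an equivelar abstract polytope of rank $n$, and let $k<m$ be ranks with $m\ge k+3$ such that every $m$-face of $\mathcal{P}$ (viewed as the section $F/F_{ -1}$, with $F_{ -1}$ the least face) is tight and every co-$k$-face of $\mathcal{P}$ (the section $F_n/G$ for a $k$-face $G$, with $F_n$ the greatest face) is tight. Then $\mathcal{P}$ is tight.
   Context: An abstract polytope of rank $n$ is a ranked poset (ranks $-1$ to $n$) with unique least face $F_{ -1}$ and greatest face $F_n$, all flags (maximal chains) having $n+2$ faces, all sections $G/F=\{H:F\le H\le G\}$ connected, and the diamond condition. It is equivelar of type $\{p_1,\ldots,p_{n-1}\}$ if for each $i$, every section $G/F$ with $F$ an $(i-2)$-face and $G$ an $(i+1)$-face is a $p_i$-gon; sections of equivelar polytopes are equivelar. An equivelar polytope of type $\{p_1,\ldots,p_{n-1}\}$ is tight if it has exactly $2p_1\cdots p_{n-1}$ flags (the minimum possible). -}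

module Defs where

open import Data.Bool using (Bool; true; false; _∧_; _∨_; not; T; if_then_else_)
open import Data.Nat using (ℕ; zero; suc; _+_; _*_; _∸_; _<_; _≤_; _≡ᵇ_)
open import Data.Integer using (ℤ; +_; _-_)
open import Data.Fin using (Fin; zero; suc; _≟_; toℕ)
open import Data.Fin.Properties using ()
open import Data.List using (List; []; _∷_; length; filterᵇ; foldr; concatMap; allFin)
open import Data.Product using (Σ; _×_)
open import Data.Vec using (Vec; []; _∷_; lookup; toList)
open import Relation.Nullary.Decidable using (⌊_⌋)
open import Relation.Binary.PropositionalEquality using (_≡_)

-- Faces of a finite poset are the elements of Fin N; the partial order is a
-- Boolean-valued relation.  Subsets of faces are Boolean vectors.

allSubsets : (N : ℕ) → List (Vec Bool N)
allSubsets zero = [] ∷ []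
allSubsets (suc N) = concatMap (λ v → (false ∷ v) ∷ (true ∷ v) ∷ []) (allSubsets N)

all : {A : Set} → (A → Bool) → List A → Bool
all p = foldr (λ x r → p x ∧ r) true

countᵇ : {A : Set} → (A → Bool) → List A → ℕ
countᵇ p xs = length (filterᵇ p xs)

prodFin : {d : ℕ} → (Fin d → ℕ) → ℕ
prodFin {zero} q = 1
prodFin {suc d} q = q zero * prodFin (λ j → q (suc j))

data Path {A : Set} (P : A → Bool) (R : A → A → Bool) : A → A → Set where
  done : ∀ {x} → Path P R x x
  step : ∀ {x y z} → T (P y) → T (R x y) → Path P R y z → Path P R x z

module Order {N : ℕ} (_≤ᵇ_ : Fin N → Fin N → Bool) where

  _≡ᶠ_ : Fin N → Fin N → Bool
  x ≡ᶠ y = ⌊ x ≟ y ⌋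

  _<ᵇ_ : Fin N → Fin N → Bool
  x <ᵇ y = (x ≤ᵇ y) ∧ not (x ≡ᶠ y)

  comparable : Fin N → Fin N → Bool
  comparable x y = (x ≤ᵇ y) ∨ (y ≤ᵇ x)

  -- membership in the section b/a = {x : a ≤ x ≤ b}
  inSec : Fin N → Fin N → Fin N → Bool
  inSec a b x = (a ≤ᵇ x) ∧ (x ≤ᵇ b)

  properSec : Fin N → Fin N → Fin N → Bool
  properSec a b x = (a <ᵇ x) ∧ (x <ᵇ b)

  faces : List (Fin N)
  faces = allFin N

  isChain : Fin N → Fin N → Vec Bool N → Bool
  isChain a b s =
    all (λ x → not (lookup s x) ∨ (inSec a b x ∧ all (λ y → not (lookup s y) ∨ comparable x y) faces)) faces

  _⊆ᵇ_ : Vec Bool N → Vec Bool N → Bool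
  s ⊆ᵇ t = all (λ x → not (lookup s x) ∨ lookup t x) faces

  isFlag : Fin N → Fin N → Vec Bool N → Bool
  isFlag a b s = isChain a b s ∧ all (λ t → not (isChain a b t ∧ (s ⊆ᵇ t)) ∨ (t ⊆ᵇ s)) (allSubsets N)

  numFlags : Fin N → Fin N → ℕ
  numFlags a b = countᵇ (isFlag a b) (allSubsets N)

  size : Vec Bool N → ℕ
  size s = countᵇ (lookup s) faces

  module Ranked (rk : Fin N → ℕ) where
    -- rk x is (rank of x) + 1, so that rk takes values in ℕ.

    SectionConnected : Fin N → Fin N → Set
    SectionConnected a b = rk a + 3 ≤ rk b →
      ∀ x y → T (properSec a b x) → T (properSec a b y) → Path (properSec a b) comparable x y

    numVertices : Fin N → Fin N → ℕ
    numVertices x y = countᵇ (λ h → (x <ᵇ h) ∧ (h <ᵇ y) ∧ (rk h ≡ᵇ suc (rk x))) faces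

    secRank : Fin N → Fin N → ℕ
    secRank a b = rk b ∸ rk a ∸ 1

    -- the section b/a is equivelar of type {q 0, …, q (d-2)} (d its rank):
    -- for j = 0 … d-2, every section y/x of b/a with x of rank j-1 and y of
    -- rank j+2 (ranks relative to b/a) is a (q j)-gon.
    EquivelarSecOfType : (a b : Fin N) → (Fin (secRank a b ∸ 1) → ℕ) → Set
    EquivelarSecOfType a b q = ∀ (j : Fin (secRank a b ∸ 1)) (x y : Fin N) →
      T (inSec a b x) → T (inSec a b y) → T (x ≤ᵇ y) →
      rk x ≡ rk a + toℕ j → rk y ≡ rk a + toℕ j + 3 →
      numVertices x y ≡ q j

    TightSec : Fin N → Fin N → Set
    TightSec a b = Σ (Fin (secRank a b ∸ 1) → ℕ) λ q →
      EquivelarSecOfType a b q × (numFlags a b ≡ 2 * prodFin q)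


record Polytope : Set₁ where
  field
    N     : ℕ
    _≤ᵇ_  : Fin N → Fin N → Bool
    ≤-refl    : ∀ x → T (x ≤ᵇ x)
    ≤-antisym : ∀ x y → T (x ≤ᵇ y) → T (y ≤ᵇ x) → x ≡ y
    ≤-trans   : ∀ x y z → T (x ≤ᵇ y) → T (y ≤ᵇ z) → T (x ≤ᵇ z)
    n     : ℕ
    rk    : Fin N → ℕ
    F₋₁   : Fin N
    Fₙ    : Fin N
    least    : ∀ x → T (F₋₁ ≤ᵇ x)
    greatest : ∀ x → T (x ≤ᵇ Fₙ)
    rk-least    : rk F₋₁ ≡ 0
    rk-greatest : rk Fₙ ≡ suc n
    rk-mono  : ∀ x y → T (Order._<ᵇ_ _≤ᵇ_ x y) → rk x < rk y
    flag-size : ∀ s → T (Order.isFlag _≤ᵇ_ F₋₁ Fₙ s) → Order.size _≤ᵇ_ s ≡ n + 2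
    connected : ∀ a b → T (a ≤ᵇ b) → Order.Ranked.SectionConnected _≤ᵇ_ rk a b
    diamond : ∀ a b → T (a ≤ᵇ b) → rk b ≡ rk a + 2 →
      countᵇ (λ h → Order._<ᵇ_ _≤ᵇ_ a h ∧ Order._<ᵇ_ _≤ᵇ_ h b) (allFin N) ≡ 2

  open Order _≤ᵇ_ public
  open Ranked rk public

  rank : Fin N → ℤ
  rank x = + (rk x) - + 1

  Equivelar : Set
  Equivelar = Σ (Fin (secRank F₋₁ Fₙ ∸ 1) → ℕ) (EquivelarSecOfType F₋₁ Fₙ)

  Tight : Set
  Tight = TightSec F₋₁ Fₙ

module Submission where

-- Counting the flags of a section b/a by their second face gives numFlags a b = Σ numFlags v b over the
-- atoms v of b/a. Every polygon y/a has q (rk a) atoms, so induction on the rank gives numFlags a b ≥ 2 ∏ q,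
-- and b/a is tight exactly when it has q (rk a) atoms and every b/v is tight. Descending from the k-faces,
-- whose co-faces are tight, we show Fₙ/a tight for the faces a of lower rank whose sections F/a under the
-- m-faces F are tight (a property that passes to the atoms of a, and holds for a = F₋₁ by hypothesis).
-- It remains to count the atoms of Fₙ/a: as m ≥ k + 3, every 3-face over a polygon y₀ of Fₙ/a lies in an
-- m-face F, and tightness of F/a and of the co-faces Fₙ/v makes the set of atoms below y₀ closed along
-- edges. The edge graph of Fₙ/a is connected since P is strongly connected, so all atoms of Fₙ/a lie
-- below y₀, and there are q (rk a) of them.

open import Defs

module Counting where

  open import Data.Bool using (Bool; true; false; _∧_; _∨_; not; T; if_then_else_)
  open import Data.Bool.Properties using (T-∧; T-∨; ∧-distribˡ-∨)
  open import Data.Empty using (⊥-elim)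
  open import Data.Fin using (Fin; zero; suc)
  open import Data.List using (List; []; _∷_; length; map; concatMap)
  open import Data.List.Membership.Propositional using (_∈_; lose)
  open import Data.List.Properties using (length-filter; filter-none; filter-some; map-cong)
  open import Data.List.Relation.Unary.All as All using (All; _∷_)
  open import Data.List.Relation.Unary.AllPairs using ([]; _∷_)
  open import Data.List.Relation.Unary.Any using (here; there)
  open import Data.List.Relation.Unary.Unique.Propositional using (Unique)
  open import Data.Nat using (ℕ; zero; suc; _+_; _*_; _≤_; _<_; z≤n; s≤s; _≡ᵇ_; _<ᵇ_)
  open import Data.Nat.ListAction using (sum)
  open import Data.Nat.Properties
  open import Algebra.Properties.CommutativeSemigroup +-commutativeSemigroup using () renaming (interchange to +-interchange)
  open import Data.Product using (∃; _×_; _,_; proj₁; proj₂)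
  open import Data.Sum using (_⊎_; inj₁; inj₂)
  open import Data.Vec using (Vec; []; _∷_; lookup; _[_]≔_)
  open import Function using (_∘_; Equivalence)
  open import Relation.Binary.PropositionalEquality using (_≡_; refl; sym; trans; cong; cong₂; subst; module ≡-Reasoning)
  open import Relation.Nullary using (¬_; contradiction; yes; no)
  open import Relation.Nullary.Decidable using (T?)

  private
    variable
      A B : Set

  ∧-elim : ∀ {x y} → T (x ∧ y) → T x × T y
  ∧-elim = Equivalence.to T-∧

  ∧-intro : ∀ {x y} → T x → T y → T (x ∧ y)
  ∧-intro p q = Equivalence.from T-∧ (p , q)

  ∨-elim : ∀ {x y} → T (x ∨ y) → T x ⊎ T y
  ∨-elim = Equivalence.to T-∨

  ∨-introˡ : ∀ {x y} → T x → T (x ∨ y)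
  ∨-introˡ p = Equivalence.from T-∨ (inj₁ p)

  ∨-introʳ : ∀ {x y} → T y → T (x ∨ y)
  ∨-introʳ p = Equivalence.from T-∨ (inj₂ p)

  ≡true⇒T : ∀ {x} → x ≡ true → T x
  ≡true⇒T refl = _

  implies-elim : ∀ {x y} → T (not x ∨ y) → T x → T y
  implies-elim {true} p _ = p

  implies-intro : ∀ {x y} → (T x → T y) → T (not x ∨ y)
  implies-intro {true}  f = f _
  implies-intro {false} _ = _

  ¬implies-elim : ∀ {x y} → ¬ T (not x ∨ y) → T x × ¬ T y
  ¬implies-elim {true}  ¬imp = _ , ¬imp
  ¬implies-elim {false} ¬imp = ⊥-elim (¬imp _)

  not-elim : ∀ {x} → T (not x) → ¬ T x
  not-elim {false} _ ()

  not-intro : ∀ {x} → ¬ T x → T (not x)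
  not-intro {true}  ¬x = ¬x _
  not-intro {false} _  = _

  all-elim : ∀ {p : A → Bool} {xs} → T (all p xs) → ∀ {x} → x ∈ xs → T (p x)
  all-elim {p = p} {y ∷ xs} h (here refl)  = proj₁ (∧-elim {p y} h)
  all-elim {p = p} {y ∷ xs} h (there x∈xs) = all-elim (proj₂ (∧-elim {p y} h)) x∈xs

  all-intro : ∀ {p : A → Bool} xs → (∀ {x} → x ∈ xs → T (p x)) → T (all p xs)
  all-intro []       _ = _
  all-intro (x ∷ xs) h = ∧-intro (h (here refl)) (all-intro xs (h ∘ there))

  all-counterexample : ∀ {p : A → Bool} xs → ¬ T (all p xs) → ∃ λ x → x ∈ xs × ¬ T (p x)
  all-counterexample []       ¬all = contradiction _ ¬all
  all-counterexample {p = p} (x ∷ xs) ¬all with p x in px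
  ... | false = x , here refl , λ q → subst T px q
  ... | true with all-counterexample xs ¬all
  ...   | y , y∈xs , ¬py = y , there y∈xs , ¬py

  module _ {p : A → Bool} where

    countᵇ-≤-length : ∀ xs → countᵇ p xs ≤ length xs
    countᵇ-≤-length = length-filter (T? ∘ p)

    countᵇ-none : ∀ {xs} → (∀ {x} → x ∈ xs → ¬ T (p x)) → countᵇ p xs ≡ 0
    countᵇ-none h = cong length (filter-none (T? ∘ p) (All.tabulate h))

    countᵇ-pos : ∀ {xs x} → x ∈ xs → T (p x) → 0 < countᵇ p xs
    countᵇ-pos x∈xs px = filter-some (T? ∘ p) (lose x∈xs px)

    countᵇ-witness : ∀ xs → 0 < countᵇ p xs → ∃ λ x → T (p x)
    countᵇ-witness (x ∷ xs) pos with p x in px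
    ... | true  = x , ≡true⇒T px
    ... | false = countᵇ-witness xs pos

    countᵇ-≤1 : ∀ {xs} → Unique xs → (∀ {x y} → T (p x) → T (p y) → x ≡ y) → countᵇ p xs ≤ 1
    countᵇ-≤1 [] _ = z≤n
    countᵇ-≤1 {x ∷ xs} (x∉xs ∷ unique) same with p x in px
    ... | true  = s≤s (≤-reflexive (countᵇ-none λ y∈xs py → All.lookup x∉xs y∈xs (same (≡true⇒T px) py)))
    ... | false = countᵇ-≤1 unique same

    countᵇ≡1 : ∀ {xs x} → Unique xs → x ∈ xs → T (p x) → (∀ {y} → T (p y) → y ≡ x) → countᵇ p xs ≡ 1
    countᵇ≡1 unique x∈xs px only =
      ≤-antisym (countᵇ-≤1 unique λ py pz → trans (only py) (sym (only pz))) (countᵇ-pos x∈xs px)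

  countᵇ-∷ : ∀ (p : A → Bool) x xs → countᵇ p (x ∷ xs) ≡ (if p x then 1 else 0) + countᵇ p xs
  countᵇ-∷ p x xs with p x
  ... | true  = refl
  ... | false = refl

  module _ {p q : A → Bool} where

    countᵇ-mono : ∀ xs → (∀ {x} → T (p x) → T (q x)) → countᵇ p xs ≤ countᵇ q xs
    countᵇ-mono [] _ = z≤n
    countᵇ-mono (x ∷ xs) p⇒q with p x in px | q x in qx
    ... | true  | true  = s≤s (countᵇ-mono xs p⇒q)
    ... | false | true  = m≤n⇒m≤1+n (countᵇ-mono xs p⇒q)
    ... | false | false = countᵇ-mono xs p⇒q
    ... | true  | false = ⊥-elim (subst T qx (p⇒q (≡true⇒T px)))

  module _ {p q : A → Bool} where

    countᵇ-cong : ∀ xs → (∀ {x} → T (p x) → T (q x)) → (∀ {x} → T (q x) → T (p x)) →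
                  countᵇ p xs ≡ countᵇ q xs
    countᵇ-cong xs p⇒q q⇒p = ≤-antisym (countᵇ-mono xs p⇒q) (countᵇ-mono xs q⇒p)

    countᵇ-≡⇒⊇ : ∀ xs → (∀ {x} → T (p x) → T (q x)) → countᵇ p xs ≡ countᵇ q xs →
                 ∀ {x} → x ∈ xs → T (q x) → T (p x)
    countᵇ-≡⇒⊇ (y ∷ xs) p⇒q eq (here refl) qy with p y | q y
    ... | true  | _     = _
    ... | false | true  = ⊥-elim (<-irrefl eq (s≤s (countᵇ-mono xs p⇒q)))
    countᵇ-≡⇒⊇ (y ∷ xs) p⇒q eq (there x∈xs) qx with p y in py | q y in qy
    ... | true  | true  = countᵇ-≡⇒⊇ xs p⇒q (suc-injective eq) x∈xs qx
    ... | false | false = countᵇ-≡⇒⊇ xs p⇒q eq x∈xs qx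
    ... | false | true  = ⊥-elim (<-irrefl eq (s≤s (countᵇ-mono xs p⇒q)))
    ... | true  | false = ⊥-elim (subst T qy (p⇒q (≡true⇒T py)))

    countᵇ-⊎ : ∀ xs → (∀ {x} → T (p x) → ¬ T (q x)) →
               countᵇ (λ x → p x ∨ q x) xs ≡ countᵇ p xs + countᵇ q xs
    countᵇ-⊎ [] _ = refl
    countᵇ-⊎ (x ∷ xs) disjoint with p x in px | q x in qx
    ... | true  | true  = ⊥-elim (disjoint (≡true⇒T px) (≡true⇒T qx))
    ... | true  | false = cong suc (countᵇ-⊎ xs disjoint)
    ... | false | true  = trans (cong suc (countᵇ-⊎ xs disjoint)) (sym (+-suc _ _))
    ... | false | false = countᵇ-⊎ xs disjoint

  countᵇ-≗ : ∀ {p q : A → Bool} xs → (∀ x → p x ≡ q x) → countᵇ p xs ≡ countᵇ q xs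
  countᵇ-≗ xs p≗q = countᵇ-cong xs (λ {x} → subst T (p≗q x)) (λ {x} → subst T (sym (p≗q x)))

  <ᵇ-suc : ∀ m k → (m <ᵇ suc k) ≡ ((m <ᵇ k) ∨ (m ≡ᵇ k))
  <ᵇ-suc zero    zero    = refl
  <ᵇ-suc zero    (suc k) = refl
  <ᵇ-suc (suc m) zero    = refl
  <ᵇ-suc (suc m) (suc k) = <ᵇ-suc m k

  module _ {p : A → Bool} (g : A → ℕ) (xs : List A)
           (fibre-≤1 : ∀ j → countᵇ (λ x → p x ∧ (g x ≡ᵇ j)) xs ≤ 1) where

    private
      below : ℕ → ℕ
      below k = countᵇ (λ x → p x ∧ (g x <ᵇ k)) xs

      below-zero : below 0 ≡ 0
      below-zero = countᵇ-none {xs = xs} λ {x} _ h → proj₂ (∧-elim {p x} h)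

      below-suc : ∀ k → below (suc k) ≡ below k + countᵇ (λ x → p x ∧ (g x ≡ᵇ k)) xs
      below-suc k = trans
        (countᵇ-≗ xs λ x → trans (cong (p x ∧_) (<ᵇ-suc (g x) k)) (∧-distribˡ-∨ (p x) _ _))
        (countᵇ-⊎ xs λ {x} h h′ → <-irrefl (≡ᵇ⇒≡ (g x) k (proj₂ (∧-elim {p x} h′)))
                                           (<ᵇ⇒< (g x) k (proj₂ (∧-elim {p x} h))))

      below-≤ : ∀ k → below k ≤ k
      below-≤ zero    = ≤-reflexive below-zero
      below-≤ (suc k) = begin
        below (suc k)                                     ≡⟨ below-suc k ⟩
        below k + countᵇ (λ x → p x ∧ (g x ≡ᵇ k)) xs      ≤⟨ +-mono-≤ (below-≤ k) (fibre-≤1 k) ⟩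
        k + 1                                             ≡⟨ +-comm k 1 ⟩
        suc k                                             ∎
        where open ≤-Reasoning

      below-< : ∀ {r} k → r < k → countᵇ (λ x → p x ∧ (g x ≡ᵇ r)) xs ≡ 0 → below k < k
      below-< {r} (suc k) r<1+k missing with r ≟ k
      ... | yes refl = begin-strict
        below (suc r)                                ≡⟨ below-suc r ⟩
        below r + countᵇ (λ x → p x ∧ (g x ≡ᵇ r)) xs ≡⟨ cong (below r +_) missing ⟩
        below r + 0                                  ≡⟨ +-identityʳ _ ⟩
        below r                                      <⟨ s≤s (below-≤ r) ⟩
        suc r                                        ∎
        where open ≤-Reasoning
      ... | no r≢k = begin-strict
        below (suc k)                                 ≡⟨ below-suc k ⟩
        below k + countᵇ (λ x → p x ∧ (g x ≡ᵇ k)) xs  <⟨ +-mono-<-≤ (below-< k r<k missing) (fibre-≤1 k) ⟩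
        k + 1                                         ≡⟨ +-comm k 1 ⟩
        suc k                                         ∎
        where
        open ≤-Reasoning
        r<k = ≤∧≢⇒< (≤-pred r<1+k) r≢k

    countᵇ-<-missing-fibre : ∀ {k r} → (∀ {x} → T (p x) → g x < k) → r < k →
                             countᵇ (λ x → p x ∧ (g x ≡ᵇ r)) xs ≡ 0 → countᵇ p xs < k
    countᵇ-<-missing-fibre {k} bounded r<k missing =
      subst (_< k) (countᵇ-cong xs (λ {x} h → proj₁ (∧-elim {p x} h))
                                   (λ {x} h → ∧-intro h (<⇒<ᵇ (bounded h))))
            (below-< k r<k missing)

  sumᵇ : (A → Bool) → (A → ℕ) → List A → ℕ
  sumᵇ c f xs = sum (map (λ x → if c x then f x else 0) xs)

  +-≤-≡⇒≡ : ∀ {a b c d} → c ≤ a → d ≤ b → a + b ≡ c + d → a ≡ c × b ≡ d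
  +-≤-≡⇒≡ {a} {b} {c} {d} c≤a d≤b eq = a≡c , +-cancelˡ-≡ c b d (subst (λ z → z + b ≡ c + d) a≡c eq)
    where
    a≡c : a ≡ c
    a≡c = ≤-antisym (+-cancelʳ-≤ b a c (≤-trans (≤-reflexive eq) (+-monoʳ-≤ c d≤b))) c≤a

  module _ (c : A → Bool) (f : A → ℕ) (L : ℕ) where

    sumᵇ-≥ : ∀ xs → (∀ {x} → T (c x) → L ≤ f x) → countᵇ c xs * L ≤ sumᵇ c f xs
    sumᵇ-≥ []       _   = z≤n
    sumᵇ-≥ (x ∷ xs) L≤f with c x in cx
    ... | true  = +-mono-≤ (L≤f (≡true⇒T cx)) (sumᵇ-≥ xs L≤f)
    ... | false = sumᵇ-≥ xs L≤f

    sumᵇ-const : ∀ xs → (∀ {x} → T (c x) → f x ≡ L) → sumᵇ c f xs ≡ countᵇ c xs * L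
    sumᵇ-const []       _   = refl
    sumᵇ-const (x ∷ xs) f≡L with c x in cx
    ... | true  = cong₂ _+_ (f≡L (≡true⇒T cx)) (sumᵇ-const xs f≡L)
    ... | false = sumᵇ-const xs f≡L

    sumᵇ-≡⇒const : ∀ xs → (∀ {x} → T (c x) → L ≤ f x) → sumᵇ c f xs ≡ countᵇ c xs * L →
                   ∀ {x} → x ∈ xs → T (c x) → f x ≡ L
    sumᵇ-≡⇒const (y ∷ xs) L≤f eq x∈ cx with c y in cy
    sumᵇ-≡⇒const (y ∷ xs) L≤f eq (here refl)  cx | true  =
      proj₁ (+-≤-≡⇒≡ (L≤f (≡true⇒T cy)) (sumᵇ-≥ xs L≤f) eq)
    sumᵇ-≡⇒const (y ∷ xs) L≤f eq (there x∈xs) cx | true  =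
      sumᵇ-≡⇒const xs L≤f (proj₂ (+-≤-≡⇒≡ (L≤f (≡true⇒T cy)) (sumᵇ-≥ xs L≤f) eq)) x∈xs cx
    sumᵇ-≡⇒const (y ∷ xs) L≤f eq (here refl)  cx | false = ⊥-elim (subst T cy cx)
    sumᵇ-≡⇒const (y ∷ xs) L≤f eq (there x∈xs) cx | false = sumᵇ-≡⇒const xs L≤f eq x∈xs cx

  sum-map-+ : ∀ (f g : A → ℕ) xs → sum (map (λ x → f x + g x) xs) ≡ sum (map f xs) + sum (map g xs)
  sum-map-+ f g []       = refl
  sum-map-+ f g (x ∷ xs) = trans (cong (f x + g x +_) (sum-map-+ f g xs))
                                 (+-interchange (f x) (g x) (sum (map f xs)) (sum (map g xs)))

  countᵇ≡sum : ∀ (p : A → Bool) xs → countᵇ p xs ≡ sum (map (λ x → if p x then 1 else 0) xs)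
  countᵇ≡sum p []       = refl
  countᵇ≡sum p (x ∷ xs) = trans (countᵇ-∷ p x xs) (cong (_ +_) (countᵇ≡sum p xs))

  countᵇ-by-partners : ∀ (R : A → B → Bool) (p : B → Bool) xs ys →
    (∀ y → countᵇ (λ x → R x y) xs ≡ (if p y then 1 else 0)) →
    countᵇ p ys ≡ sum (map (λ x → countᵇ (R x) ys) xs)
  countᵇ-by-partners R p xs [] _ = sym (sum-zeros xs)
    where
    sum-zeros : ∀ xs → sum (map (λ _ → 0) xs) ≡ 0
    sum-zeros []       = refl
    sum-zeros (_ ∷ xs) = sum-zeros xs
  countᵇ-by-partners R p xs (y ∷ ys) partners = begin
    countᵇ p (y ∷ ys)
      ≡⟨ countᵇ-∷ p y ys ⟩
    (if p y then 1 else 0) + countᵇ p ys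
      ≡⟨ cong₂ _+_ (sym (partners y)) (countᵇ-by-partners R p xs ys partners) ⟩
    countᵇ (λ x → R x y) xs + sum (map (λ x → countᵇ (R x) ys) xs)
      ≡⟨ cong (_+ _) (countᵇ≡sum (λ x → R x y) xs) ⟩
    sum (map (λ x → if R x y then 1 else 0) xs) + sum (map (λ x → countᵇ (R x) ys) xs)
      ≡⟨ sym (sum-map-+ _ _ xs) ⟩
    sum (map (λ x → (if R x y then 1 else 0) + countᵇ (R x) ys) xs)
      ≡⟨ cong sum (map-cong (λ x → sym (countᵇ-∷ (R x) y ys)) xs) ⟩
    sum (map (λ x → countᵇ (R x) (y ∷ ys)) xs)
      ∎
    where open ≡-Reasoning

  countᵇ-allSubsets-suc : ∀ {N} (p : Vec Bool (suc N) → Bool) →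
    countᵇ p (allSubsets (suc N)) ≡
    countᵇ (p ∘ (false ∷_)) (allSubsets N) + countᵇ (p ∘ (true ∷_)) (allSubsets N)
  countᵇ-allSubsets-suc {N} p = go (allSubsets N)
    where
    go : ∀ vs → countᵇ p (concatMap (λ v → (false ∷ v) ∷ (true ∷ v) ∷ []) vs) ≡
                countᵇ (p ∘ (false ∷_)) vs + countᵇ (p ∘ (true ∷_)) vs
    go []       = refl
    go (v ∷ vs) with p (false ∷ v)
    ... | true with p (true ∷ v)
    ...   | true  = cong suc (trans (cong suc (go vs)) (sym (+-suc _ _)))
    ...   | false = cong suc (go vs)
    go (v ∷ vs) | false with p (true ∷ v)
    ...   | true  = trans (cong suc (go vs)) (sym (+-suc _ _))
    ...   | false = go vs

  ∈-allSubsets : ∀ {N} (s : Vec Bool N) → s ∈ allSubsets N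
  ∈-allSubsets []      = here refl
  ∈-allSubsets (b ∷ s) = ∈-concatMap b (∈-allSubsets s)
    where
    ∈-concatMap : ∀ {N} {v : Vec Bool N} {vs} b → v ∈ vs →
                  (b ∷ v) ∈ concatMap (λ v → (false ∷ v) ∷ (true ∷ v) ∷ []) vs
    ∈-concatMap false (here refl)  = here refl
    ∈-concatMap true  (here refl)  = there (here refl)
    ∈-concatMap b     (there v∈vs) = there (there (∈-concatMap b v∈vs))

  countᵇ-allSubsets-insert : ∀ {N} (i : Fin N) (p : Vec Bool N → Bool) →
    (∀ {s} → T (p s) → T (lookup s i)) →
    countᵇ p (allSubsets N) ≡ countᵇ (λ t → not (lookup t i) ∧ p (t [ i ]≔ true)) (allSubsets N)
  countᵇ-allSubsets-insert {suc N} zero p p⇒i = begin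
    countᵇ p (allSubsets (suc N))              ≡⟨ countᵇ-allSubsets-suc p ⟩
    countᵇ (p ∘ (false ∷_)) subsets + containing-0
      ≡⟨ cong (_+ containing-0) (countᵇ-none {p = p ∘ (false ∷_)} {subsets} λ _ → p⇒i) ⟩
    containing-0                                     ≡⟨ sym (+-identityʳ containing-0) ⟩
    containing-0 + 0
      ≡⟨ cong (containing-0 +_) (sym (countᵇ-none {p = λ _ → false} {subsets} λ _ ())) ⟩
    containing-0 + countᵇ (λ _ → false) subsets      ≡⟨ sym (countᵇ-allSubsets-suc drop-0) ⟩
    countᵇ drop-0 (allSubsets (suc N))      ∎
    where
    open ≡-Reasoning
    subsets = allSubsets N
    containing-0 = countᵇ (p ∘ (true ∷_)) subsets
    drop-0 : Vec Bool (suc N) → Bool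
    drop-0 t = not (lookup t zero) ∧ p (t [ zero ]≔ true)
  countᵇ-allSubsets-insert {suc N} (suc i) p p⇒i =
    trans (countᵇ-allSubsets-suc p)
      (trans (cong₂ _+_ (countᵇ-allSubsets-insert i (p ∘ (false ∷_)) p⇒i)
                        (countᵇ-allSubsets-insert i (p ∘ (true ∷_)) p⇒i))
             (sym (countᵇ-allSubsets-suc (λ t → not (lookup t (suc i)) ∧ p (t [ suc i ]≔ true)))))

module Faces (P : Polytope) where

  open import Data.Bool using (Bool; true; false; _∧_; _∨_; not; T; if_then_else_)
  open import Data.Empty using (⊥-elim)
  open import Data.Fin using (Fin; _≟_)
  open import Data.List using (List; filterᵇ; map)
  open import Data.List.Extrema.Nat using (argmin; argmin-all; f[argmin]≤f[xs])
  open import Data.List.Membership.Propositional.Properties using (∈-allFin; ∈-filter⁺)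
  open import Data.List.Properties using (length-tabulate; map-cong)
  open import Data.List.Relation.Unary.All as All using (All)
  open import Data.List.Relation.Unary.All.Properties using (all-filter)
  open import Data.List.Relation.Unary.Unique.Propositional.Properties using (allFin⁺)
  open import Data.Nat using (ℕ; zero; suc; _+_; _∸_; _≤_; _<_; _≡ᵇ_; s≤s; z≤n)
  open import Data.Nat.Induction using (<-wellFounded)
  open import Data.Nat.ListAction using (sum)
  import Data.Nat.Properties as ℕ
  open import Data.Product using (∃; ∃₂; _×_; _,_; proj₁; proj₂)
  open import Data.Sum using (_⊎_; inj₁; inj₂; [_,_])
  open import Data.Vec using (Vec; lookup; replicate; _[_]≔_)
  open import Data.Vec.Properties using (lookup∘update; lookup∘update′; lookup-replicate)
  open import Function using (_∘_; id; flip)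
  open import Induction.WellFounded using (Acc; acc)
  open import Relation.Binary.PropositionalEquality using (_≡_; _≢_; refl; sym; trans; cong; subst; module ≡-Reasoning)
  open import Relation.Nullary using (¬_; contradiction; yes; no)
  open import Relation.Nullary.Decidable using (T?)
  open Counting

  open Polytope P hiding (≤-refl; ≤-trans; ≤-antisym)

  _≼_ _≺_ _∼_ : Fin N → Fin N → Set
  x ≼ y = T (x ≤ᵇ y)
  x ≺ y = T (x <ᵇ y)
  x ∼ y = T (comparable x y)

  ≼-refl : ∀ {x} → x ≼ x
  ≼-refl {x} = Polytope.≤-refl P x

  ≼-trans : ∀ {x y z} → x ≼ y → y ≼ z → x ≼ z
  ≼-trans {x} {y} {z} = Polytope.≤-trans P x y z

  ≼-antisym : ∀ {x y} → x ≼ y → y ≼ x → x ≡ y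
  ≼-antisym {x} {y} = Polytope.≤-antisym P x y

  ≺⇒≼ : ∀ {x y} → x ≺ y → x ≼ y
  ≺⇒≼ {x} {y} x≺y = proj₁ (∧-elim {x ≤ᵇ y} x≺y)

  ≺⇒rk< : ∀ {x y} → x ≺ y → rk x < rk y
  ≺⇒rk< {x} {y} = rk-mono x y

  ≺⇒≢ : ∀ {x y} → x ≺ y → x ≢ y
  ≺⇒≢ x≺y refl = ℕ.<-irrefl refl (≺⇒rk< x≺y)

  ≼∧≢⇒≺ : ∀ {x y} → x ≼ y → x ≢ y → x ≺ y
  ≼∧≢⇒≺ {x} {y} x≼y x≢y with x ≟ y
  ... | yes x≡y = contradiction x≡y x≢y
  ... | no  _   = ∧-intro x≼y _

  ≼⇒rk≤ : ∀ {x y} → x ≼ y → rk x ≤ rk y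
  ≼⇒rk≤ {x} {y} x≼y with x ≟ y
  ... | yes refl = ℕ.≤-refl
  ... | no x≢y   = ℕ.<⇒≤ (≺⇒rk< (≼∧≢⇒≺ x≼y x≢y))

  ≼∧rk≤⇒≡ : ∀ {x y} → x ≼ y → rk y ≤ rk x → x ≡ y
  ≼∧rk≤⇒≡ {x} {y} x≼y rky≤rkx with x ≟ y
  ... | yes x≡y = x≡y
  ... | no x≢y  = contradiction rky≤rkx (ℕ.<⇒≱ (≺⇒rk< (≼∧≢⇒≺ x≼y x≢y)))

  ≼∧rk<⇒≺ : ∀ {x y} → x ≼ y → rk x < rk y → x ≺ y
  ≼∧rk<⇒≺ x≼y rkx<rky = ≼∧≢⇒≺ x≼y λ { refl → ℕ.<-irrefl refl rkx<rky }

  ≺-≼-trans : ∀ {x y z} → x ≺ y → y ≼ z → x ≺ z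
  ≺-≼-trans x≺y y≼z = ≼∧rk<⇒≺ (≼-trans (≺⇒≼ x≺y) y≼z) (ℕ.<-≤-trans (≺⇒rk< x≺y) (≼⇒rk≤ y≼z))

  ≼∧gap⇒≺ : ∀ {x y l} → x ≼ y → rk y ≡ 2 + l + rk x → x ≺ y
  ≼∧gap⇒≺ {x} x≼y rky = ≼∧rk<⇒≺ x≼y (subst (rk x <_) (sym rky) (ℕ.m<n+m (rk x) (s≤s z≤n)))

  rk≤rkFₙ : ∀ x → rk x ≤ suc n
  rk≤rkFₙ x = subst (rk x ≤_) rk-greatest (≼⇒rk≤ (greatest x))

  ≼⇒∼ : ∀ {x y} → x ≼ y → x ∼ y
  ≼⇒∼ = ∨-introˡ

  ≽⇒∼ : ∀ {x y} → y ≼ x → x ∼ y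
  ≽⇒∼ {x} {y} = ∨-introʳ {x ≤ᵇ y}

  ∼-refl : ∀ {x} → x ∼ x
  ∼-refl = ≼⇒∼ ≼-refl

  ∼-sym : ∀ {x y} → x ∼ y → y ∼ x
  ∼-sym {x} {y} x∼y with ∨-elim {x ≤ᵇ y} x∼y
  ... | inj₁ x≼y = ≽⇒∼ x≼y
  ... | inj₂ y≼x = ≼⇒∼ y≼x

  ∼∧rk≤⇒≼ : ∀ {x y} → x ∼ y → rk x ≤ rk y → x ≼ y
  ∼∧rk≤⇒≼ {x} {y} x∼y rkx≤rky with ∨-elim {x ≤ᵇ y} x∼y
  ... | inj₁ x≼y = x≼y
  ... | inj₂ y≼x = subst (x ≼_) (sym (≼∧rk≤⇒≡ y≼x rkx≤rky)) ≼-refl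

  ∼∧rk≡⇒≡ : ∀ {x y} → x ∼ y → rk x ≡ rk y → x ≡ y
  ∼∧rk≡⇒≡ x∼y rkx≡rky = ≼∧rk≤⇒≡ (∼∧rk≤⇒≼ x∼y (ℕ.≤-reflexive rkx≡rky)) (ℕ.≤-reflexive (sym rkx≡rky))

  Subset : Set
  Subset = Vec Bool N

  -- A record rather than T (lookup s x), so that x and s can be inferred from a membership proof.
  record _∈ₛ_ (x : Fin N) (s : Subset) : Set where
    constructor member
    field isMember : T (lookup s x)

  open _∈ₛ_

  _⊆ₛ_ : Subset → Subset → Set
  s ⊆ₛ t = ∀ {x} → x ∈ₛ s → x ∈ₛ t

  ∅ : Subset
  ∅ = replicate N false

  insert delete : Fin N → Subset → Subset
  insert x s = s [ x ]≔ true
  delete x s = s [ x ]≔ false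

  ∉∅ : ∀ {x} → ¬ x ∈ₛ ∅
  ∉∅ {x} (member x∈∅) = subst T (lookup-replicate x false) x∈∅

  ∈-insert-self : ∀ x s → x ∈ₛ insert x s
  ∈-insert-self x s = member (subst T (sym (lookup∘update x s true)) _)

  ∈-insert⁺ : ∀ x {y s} → y ∈ₛ s → y ∈ₛ insert x s
  ∈-insert⁺ x {y} {s} y∈s with x ≟ y
  ... | yes refl = ∈-insert-self x s
  ... | no x≢y   = member (subst T (sym (lookup∘update′ (x≢y ∘ sym) s true)) (isMember y∈s))

  ∈-insert⁻ : ∀ x {y} s → y ∈ₛ insert x s → y ≡ x ⊎ y ∈ₛ s
  ∈-insert⁻ x {y} s (member y∈) with x ≟ y
  ... | yes refl = inj₁ refl
  ... | no x≢y   = inj₂ (member (subst T (lookup∘update′ (x≢y ∘ sym) s true) y∈))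

  ∈-insert⁻-≢ : ∀ x {y} s → y ≢ x → y ∈ₛ insert x s → y ∈ₛ s
  ∈-insert⁻-≢ x s y≢x y∈ = [ flip contradiction y≢x , id ] (∈-insert⁻ x s y∈)

  ∈-delete⁺ : ∀ x {y s} → y ≢ x → y ∈ₛ s → y ∈ₛ delete x s
  ∈-delete⁺ x {y} {s} y≢x (member y∈s) = member (subst T (sym (lookup∘update′ y≢x s false)) y∈s)

  ∈-delete⁻ : ∀ x {y} s → y ∈ₛ delete x s → y ≢ x × y ∈ₛ s
  ∈-delete⁻ x {y} s (member y∈) with x ≟ y
  ... | yes refl = contradiction y∈ (subst T (lookup∘update x s false))
  ... | no x≢y   = x≢y ∘ sym , member (subst T (lookup∘update′ (x≢y ∘ sym) s false) y∈)

  minimal-member : ∀ {s x₀} → x₀ ∈ₛ s → ∃ λ w → w ∈ₛ s × (∀ {x} → x ∈ₛ s → rk w ≤ rk x)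
  minimal-member {s} {x₀} x₀∈s =
    argmin rk x₀ members ,
    argmin-all rk x₀∈s (All.map member (all-filter (T? ∘ lookup s) faces)) ,
    λ {x} x∈s → All.lookup (f[argmin]≤f[xs] x₀ members)
                           (∈-filter⁺ (T? ∘ lookup s) (∈-allFin x) (isMember x∈s))
    where
    members = filterᵇ (lookup s) faces

  record IsChain (a b : Fin N) (s : Subset) : Set where
    field
      above  : ∀ {x} → x ∈ₛ s → a ≼ x
      below  : ∀ {x} → x ∈ₛ s → x ≼ b
      linear : ∀ {x y} → x ∈ₛ s → y ∈ₛ s → x ∼ y

  record IsFlag (a b : Fin N) (f : Subset) : Set where
    field
      chain   : IsChain a b f
      maximal : ∀ {t} → IsChain a b t → f ⊆ₛ t → t ⊆ₛ f

  open IsChain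
  open IsFlag

  ⊆ᵇ⇒⊆ₛ : ∀ {s t} → T (s ⊆ᵇ t) → s ⊆ₛ t
  ⊆ᵇ⇒⊆ₛ s⊆t {x} (member x∈s) = member (implies-elim (all-elim s⊆t (∈-allFin x)) x∈s)

  ⊆ₛ⇒⊆ᵇ : ∀ {s t} → s ⊆ₛ t → T (s ⊆ᵇ t)
  ⊆ₛ⇒⊆ᵇ s⊆t = all-intro faces λ _ → implies-intro (isMember ∘ s⊆t ∘ member)

  isChain⇒IsChain : ∀ {a b s} → T (isChain a b s) → IsChain a b s
  isChain⇒IsChain {a} {b} {s} h = record
    { above  = λ {x} x∈s → proj₁ (∧-elim {a ≤ᵇ x} (proj₁ (∧-elim {inSec a b x} (conditions x∈s))))
    ; below  = λ {x} x∈s → proj₂ (∧-elim {a ≤ᵇ x} (proj₁ (∧-elim {inSec a b x} (conditions x∈s))))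
    ; linear = λ {x} {y} x∈s y∈s →
        implies-elim (all-elim (proj₂ (∧-elim {inSec a b x} (conditions x∈s))) (∈-allFin y)) (isMember y∈s)
    }
    where
    conditions : ∀ {x} → x ∈ₛ s → T (inSec a b x ∧ all (λ y → not (lookup s y) ∨ comparable x y) faces)
    conditions {x} (member x∈s) = implies-elim (all-elim h (∈-allFin x)) x∈s

  IsChain⇒isChain : ∀ {a b s} → IsChain a b s → T (isChain a b s)
  IsChain⇒isChain c = all-intro faces λ _ → implies-intro λ x∈s →
    ∧-intro (∧-intro (above c (member x∈s)) (below c (member x∈s)))
            (all-intro faces λ _ → implies-intro (linear c (member x∈s) ∘ member))

  isFlag⇒IsFlag : ∀ {a b f} → T (isFlag a b f) → IsFlag a b f
  isFlag⇒IsFlag {a} {b} {f} h = record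
    { chain   = isChain⇒IsChain (proj₁ (∧-elim h))
    ; maximal = λ {t} t-chain f⊆t →
        ⊆ᵇ⇒⊆ₛ (implies-elim (all-elim (proj₂ (∧-elim {isChain a b f} h)) (∈-allSubsets t))
                            (∧-intro (IsChain⇒isChain t-chain) (⊆ₛ⇒⊆ᵇ f⊆t)))
    }

  IsFlag⇒isFlag : ∀ {a b f} → IsFlag a b f → T (isFlag a b f)
  IsFlag⇒isFlag {a} {b} flag =
    ∧-intro (IsChain⇒isChain (chain flag)) (all-intro (allSubsets N) λ {t} _ → implies-intro λ h →
      let t-chain , f⊆t = ∧-elim {isChain a b t} h
      in ⊆ₛ⇒⊆ᵇ (maximal flag (isChain⇒IsChain {a} {b} {t} t-chain) (⊆ᵇ⇒⊆ₛ f⊆t)))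

  ¬isFlag⇒extension : ∀ {a b s} → IsChain a b s → ¬ T (isFlag a b s) →
                      ∃ λ t → IsChain a b t × s ⊆ₛ t × ¬ t ⊆ₛ s
  ¬isFlag⇒extension {a} {b} {s} s-chain ¬flag
    with all-counterexample (allSubsets N) (¬flag ∘ ∧-intro (IsChain⇒isChain s-chain))
  ... | t , _ , ¬implies with ¬implies-elim {isChain a b t ∧ (s ⊆ᵇ t)} ¬implies
  ...   | larger , ¬t⊆s = t , isChain⇒IsChain {a} {b} {t} t-chain , ⊆ᵇ⇒⊆ₛ s⊆t , ¬t⊆s ∘ ⊆ₛ⇒⊆ᵇ
    where
    t-chain = proj₁ (∧-elim {isChain a b t} larger)
    s⊆t     = proj₂ (∧-elim {isChain a b t} larger)

  size-≤ : ∀ s → size s ≤ N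
  size-≤ s = subst (size s ≤_) (length-tabulate id) (countᵇ-≤-length faces)

  size-< : ∀ {s t} → s ⊆ₛ t → ¬ t ⊆ₛ s → size s < size t
  size-< {s} {t} s⊆t ¬t⊆s = ℕ.≤∧≢⇒< (countᵇ-mono faces s⊆ᵗ) λ same-size →
    ¬t⊆s λ {x} x∈t → member (countᵇ-≡⇒⊇ faces s⊆ᵗ same-size (∈-allFin x) (isMember x∈t))
    where
    s⊆ᵗ : ∀ {x} → T (lookup s x) → T (lookup t x)
    s⊆ᵗ = isMember ∘ s⊆t ∘ member

  ∅-chain : ∀ {a b} → IsChain a b ∅
  ∅-chain = record { above = ⊥-elim ∘ ∉∅ ; below = ⊥-elim ∘ ∉∅ ; linear = λ x∈∅ _ → ⊥-elim (∉∅ x∈∅) }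

  chain-insert : ∀ {a b s x} → IsChain a b s → a ≼ x → x ≼ b → (∀ {y} → y ∈ₛ s → x ∼ y) →
                 IsChain a b (insert x s)
  chain-insert {a} {b} {s} {x} s-chain a≼x x≼b x∼s = record
    { above  = λ y∈ → [ (λ { refl → a≼x }) , above s-chain ] (∈-insert⁻ x s y∈)
    ; below  = λ y∈ → [ (λ { refl → x≼b }) , below s-chain ] (∈-insert⁻ x s y∈)
    ; linear = λ y∈ z∈ → linear′ (∈-insert⁻ x s y∈) (∈-insert⁻ x s z∈)
    }
    where
    linear′ : ∀ {y z} → y ≡ x ⊎ y ∈ₛ s → z ≡ x ⊎ z ∈ₛ s → y ∼ z
    linear′ (inj₁ refl) (inj₁ refl) = ∼-refl
    linear′ (inj₁ refl) (inj₂ z∈s)  = x∼s z∈s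
    linear′ (inj₂ y∈s)  (inj₁ refl) = ∼-sym (x∼s y∈s)
    linear′ (inj₂ y∈s)  (inj₂ z∈s)  = linear s-chain y∈s z∈s

  chain-lower : ∀ {a a′ b s} → a′ ≼ a → IsChain a b s → IsChain a′ b s
  chain-lower a′≼a s-chain = record
    { above = ≼-trans a′≼a ∘ above s-chain ; below = below s-chain ; linear = linear s-chain }

  extend-to-flag : ∀ {a b s} → IsChain a b s → ∃ λ f → IsFlag a b f × s ⊆ₛ f
  extend-to-flag {a} {b} {s} = extend (N ∸ size s) (ℕ.≤-reflexive (sym (ℕ.m∸n+n≡m (size-≤ s))))
    where
    extend : ∀ k {s} → N ≤ k + size s → IsChain a b s → ∃ λ f → IsFlag a b f × s ⊆ₛ f
    extend k {s} bound s-chain with isFlag a b s in is-flag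
    ... | true  = s , isFlag⇒IsFlag (≡true⇒T is-flag) , id
    ... | false with ¬isFlag⇒extension s-chain (subst T is-flag) | k
    ...   | t , t-chain , s⊆t , ¬t⊆s | zero  =
      contradiction (size-≤ t) (ℕ.<⇒≱ (ℕ.≤-<-trans bound (size-< s⊆t ¬t⊆s)))
    ...   | t , t-chain , s⊆t , ¬t⊆s | suc k =
      let f , f-flag , t⊆f = extend k (ℕ.≤-trans bound (ℕ.≤-trans (ℕ.≤-reflexive (sym (ℕ.+-suc k (size s))))
                                                                (ℕ.+-monoʳ-≤ k (size-< s⊆t ¬t⊆s)))) t-chain
      in f , f-flag , t⊆f ∘ s⊆t

  numFlags-pos : ∀ a b → 0 < numFlags a b
  numFlags-pos a b with extend-to-flag {a} {b} ∅-chain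
  ... | f , f-flag , _ = countᵇ-pos (∈-allSubsets f) (IsFlag⇒isFlag f-flag)

  flag-member : ∀ {a b f x} → IsFlag a b f → a ≼ x → x ≼ b → (∀ {y} → y ∈ₛ f → x ∼ y) → x ∈ₛ f
  flag-member {f = f} {x} f-flag a≼x x≼b x∼f =
    maximal f-flag (chain-insert (chain f-flag) a≼x x≼b x∼f) (∈-insert⁺ x) (∈-insert-self x f)

  flag-bottom : ∀ {a b f} → IsFlag a b f → a ≼ b → a ∈ₛ f
  flag-bottom f-flag a≼b = flag-member f-flag ≼-refl a≼b (≼⇒∼ ∘ above (chain f-flag))

  flag-top : ∀ {a b f} → IsFlag a b f → a ≼ b → b ∈ₛ f
  flag-top f-flag a≼b = flag-member f-flag a≼b ≼-refl (≽⇒∼ ∘ below (chain f-flag))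

  flag-bottom-unique : ∀ {v w b t} → IsFlag v b t → IsFlag w b t → v ≼ b → w ≼ b → v ≡ w
  flag-bottom-unique v-flag w-flag v≼b w≼b =
    ≼-antisym (above (chain v-flag) (flag-bottom w-flag w≼b)) (above (chain w-flag) (flag-bottom v-flag v≼b))

  -- A flag has n + 2 faces of pairwise distinct ranks in {0, …, n + 1}, so it meets every rank.
  flag-hits-rank : ∀ {f r} → IsFlag F₋₁ Fₙ f → r ≤ suc n → ∃ λ c → c ∈ₛ f × rk c ≡ r
  flag-hits-rank {f} {r} f-flag r≤1+n with countᵇ (λ x → lookup f x ∧ (rk x ≡ᵇ r)) faces in fibre-r
  ... | suc _ with countᵇ-witness faces (subst (0 <_) (sym fibre-r) (s≤s z≤n))
  ...   | c , h = c , member (proj₁ (∧-elim h)) , ℕ.≡ᵇ⇒≡ (rk c) r (proj₂ (∧-elim {lookup f c} h))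
  flag-hits-rank {f} {r} f-flag r≤1+n | zero =
    contradiction (countᵇ-<-missing-fibre rk faces fibre-≤1 (λ {x} _ → s≤s (rk≤rkFₙ x)) (s≤s r≤1+n) fibre-r)
                  (ℕ.<-irrefl (trans (flag-size f (IsFlag⇒isFlag f-flag)) (ℕ.+-comm n 2)))
    where
    fibre-≤1 : ∀ j → countᵇ (λ x → lookup f x ∧ (rk x ≡ᵇ j)) faces ≤ 1
    fibre-≤1 j = countᵇ-≤1 (allFin⁺ N) λ {x} {y} hx hy →
      let x∈f , rkx≡j = ∧-elim {lookup f x} hx
          y∈f , rky≡j = ∧-elim {lookup f y} hy
      in ∼∧rk≡⇒≡ (linear (chain f-flag) (member x∈f) (member y∈f))
                 (trans (ℕ.≡ᵇ⇒≡ (rk x) j rkx≡j) (sym (ℕ.≡ᵇ⇒≡ (rk y) j rky≡j)))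

  pair-chain : ∀ {a b} → a ≼ b → IsChain F₋₁ Fₙ (insert b (insert a ∅))
  pair-chain {a} {b} a≼b = chain-insert (chain-insert ∅-chain (least a) (greatest a) (⊥-elim ∘ ∉∅))
                                        (least b) (greatest b)
                                        λ y∈ → [ (λ { refl → ≽⇒∼ a≼b }) , ⊥-elim ∘ ∉∅ ] (∈-insert⁻ a ∅ y∈)

  face-between : ∀ {a b r} → a ≼ b → rk a ≤ r → r ≤ rk b → ∃ λ c → a ≼ c × c ≼ b × rk c ≡ r
  face-between {a} {b} {r} a≼b rka≤r r≤rkb with extend-to-flag (pair-chain a≼b)
  ... | f , f-flag , ab⊆f with flag-hits-rank f-flag (ℕ.≤-trans r≤rkb (rk≤rkFₙ b))
  ...   | c , c∈f , rkc≡r =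
    c , ∼∧rk≤⇒≼ (linear (chain f-flag) a∈f c∈f) (subst (rk a ≤_) (sym rkc≡r) rka≤r)
      , ∼∧rk≤⇒≼ (linear (chain f-flag) c∈f b∈f) (subst (_≤ rk b) (sym rkc≡r) r≤rkb)
      , rkc≡r
    where
    a∈f = ab⊆f (∈-insert⁺ b (∈-insert-self a ∅))
    b∈f = ab⊆f (∈-insert-self b (insert a ∅))

  polygon-between : ∀ {a b j} → a ≼ b → rk a ≤ j → 3 + j ≤ rk b →
                    ∃₂ λ x y → a ≼ x × x ≼ y × y ≼ b × rk x ≡ j × rk y ≡ 3 + rk x
  polygon-between {a} {b} {j} a≼b rka≤j 3+j≤rkb
    with face-between a≼b rka≤j (ℕ.≤-trans (ℕ.m≤n+m j 3) 3+j≤rkb)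
  ... | x , a≼x , x≼b , refl with face-between x≼b (ℕ.m≤n+m (rk x) 3) 3+j≤rkb
  ...   | y , x≼y , y≼b , rky = x , y , a≼x , x≼y , y≼b , refl , rky

  atomᵇ : Fin N → Fin N → Fin N → Bool
  atomᵇ a b v = (a <ᵇ v) ∧ ((v ≤ᵇ b) ∧ (rk v ≡ᵇ suc (rk a)))

  numAtoms : Fin N → Fin N → ℕ
  numAtoms a b = countᵇ (atomᵇ a b) faces

  record Atom (a b v : Fin N) : Set where
    field
      over   : a ≼ v
      under  : v ≼ b
      covers : rk v ≡ suc (rk a)

  atomᵇ⇒Atom : ∀ {a b v} → T (atomᵇ a b v) → Atom a b v
  atomᵇ⇒Atom {a} {b} {v} h = record
    { over = ≺⇒≼ (proj₁ a≺v,rest) ; under = proj₁ rest ; covers = ℕ.≡ᵇ⇒≡ (rk v) (suc (rk a)) (proj₂ rest) }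
    where
    a≺v,rest = ∧-elim {a <ᵇ v} h
    rest = ∧-elim {v ≤ᵇ b} (proj₂ a≺v,rest)

  Atom⇒≺ : ∀ {a b v} → Atom a b v → a ≺ v
  Atom⇒≺ v-atom = ≼∧rk<⇒≺ (Atom.over v-atom) (ℕ.≤-reflexive (sym (Atom.covers v-atom)))

  Atom⇒atomᵇ : ∀ {a b v} → Atom a b v → T (atomᵇ a b v)
  Atom⇒atomᵇ {a} {b} {v} v-atom =
    ∧-intro (Atom⇒≺ v-atom) (∧-intro (Atom.under v-atom) (ℕ.≡⇒≡ᵇ (rk v) (suc (rk a)) (Atom.covers v-atom)))

  atom-below : ∀ {a b c v} → Atom a b v → v ≼ c → Atom a c v
  atom-below v-atom v≼c = record { over = Atom.over v-atom ; under = v≼c ; covers = Atom.covers v-atom }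

  atomᵇ-mono : ∀ {a b c v} → b ≼ c → T (atomᵇ a b v) → T (atomᵇ a c v)
  atomᵇ-mono b≼c h = let v-atom = atomᵇ⇒Atom h in Atom⇒atomᵇ (atom-below v-atom (≼-trans (Atom.under v-atom) b≼c))

  atom-≼ : ∀ {a b v y} → Atom a b v → a ≺ y → y ∼ v → v ≼ y
  atom-≼ {y = y} v-atom a≺y y∼v = ∼∧rk≤⇒≼ (∼-sym y∼v) (subst (_≤ rk y) (sym (Atom.covers v-atom)) (≺⇒rk< a≺y))

  atom-≡ : ∀ {a b v} → Atom a b v → rk b ≡ suc (rk a) → v ≡ b
  atom-≡ v-atom rkb = ≼∧rk≤⇒≡ (Atom.under v-atom) (ℕ.≤-reflexive (trans rkb (sym (Atom.covers v-atom))))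

  atom-≺ : ∀ {a b v} → Atom a b v → suc (suc (rk a)) ≤ rk b → v ≺ b
  atom-≺ {b = b} v-atom 2+rka≤rkb =
    ≼∧rk<⇒≺ (Atom.under v-atom) (subst (_< rk b) (sym (Atom.covers v-atom)) 2+rka≤rkb)

  atom-exists : ∀ {a b} → a ≺ b → ∃ λ v → Atom a b v
  atom-exists {a} a≺b with face-between (≺⇒≼ a≺b) (ℕ.n≤1+n (rk a)) (≺⇒rk< a≺b)
  ... | v , a≼v , v≼b , rkv = v , record { over = a≼v ; under = v≼b ; covers = rkv }

  numAtoms-pos : ∀ {a b} → a ≺ b → 0 < numAtoms a b
  numAtoms-pos a≺b with atom-exists a≺b
  ... | v , v-atom = countᵇ-pos (∈-allFin v) (Atom⇒atomᵇ v-atom)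

  numVertices≡numAtoms : ∀ {a b} → suc (suc (rk a)) ≤ rk b → numVertices a b ≡ numAtoms a b
  numVertices≡numAtoms {a} {b} 2+rka≤rkb = countᵇ-cong faces vertex⇒atom atom⇒vertex
    where
    vertex⇒atom : ∀ {v} → T ((a <ᵇ v) ∧ (v <ᵇ b) ∧ (rk v ≡ᵇ suc (rk a))) → T (atomᵇ a b v)
    vertex⇒atom {v} h = let a≺v , rest = ∧-elim {a <ᵇ v} h ; v≺b , rkv = ∧-elim {v <ᵇ b} rest
                        in ∧-intro a≺v (∧-intro (≺⇒≼ v≺b) rkv)
    atom⇒vertex : ∀ {v} → T (atomᵇ a b v) → T ((a <ᵇ v) ∧ (v <ᵇ b) ∧ (rk v ≡ᵇ suc (rk a)))
    atom⇒vertex {v} h = let a≺v , rest = ∧-elim {a <ᵇ v} h ; _ , rkv = ∧-elim {v ≤ᵇ b} rest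
                        in ∧-intro a≺v (∧-intro (atom-≺ (atomᵇ⇒Atom h) 2+rka≤rkb) rkv)

  numAtoms-edge : ∀ {a b} → a ≼ b → rk b ≡ suc (suc (rk a)) → numAtoms a b ≡ 2
  numAtoms-edge {a} {b} a≼b rkb = trans (countᵇ-cong faces atom⇒between between⇒atom)
                                        (diamond a b a≼b (trans rkb (ℕ.+-comm 2 (rk a))))
    where
    atom⇒between : ∀ {v} → T (atomᵇ a b v) → T ((a <ᵇ v) ∧ (v <ᵇ b))
    atom⇒between h = ∧-intro (Atom⇒≺ (atomᵇ⇒Atom h)) (atom-≺ (atomᵇ⇒Atom h) (ℕ.≤-reflexive (sym rkb)))
    between⇒atom : ∀ {v} → T ((a <ᵇ v) ∧ (v <ᵇ b)) → T (atomᵇ a b v)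
    between⇒atom {v} h = let a≺v , v≺b = ∧-elim {a <ᵇ v} h in Atom⇒atomᵇ (record
      { over = ≺⇒≼ a≺v ; under = ≺⇒≼ v≺b
      ; covers = ℕ.≤-antisym (ℕ.≤-pred (subst (rk v <_) rkb (≺⇒rk< v≺b))) (≺⇒rk< a≺v) })

  flag-lift : ∀ {a b v t} → Atom a b v → IsFlag v b t → ¬ a ∈ₛ t × IsFlag a b (insert a t)
  flag-lift {a} {b} {v} {t} v-atom t-flag = a∉t , record { chain = t⁺-chain ; maximal = t⁺-maximal }
    where
    a≼v = Atom.over v-atom
    v∈t = flag-bottom t-flag (Atom.under v-atom)

    a∉t : ¬ a ∈ₛ t
    a∉t a∈t = ℕ.<⇒≱ (≺⇒rk< (Atom⇒≺ v-atom)) (≼⇒rk≤ (above (chain t-flag) a∈t))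

    t⁺-chain : IsChain a b (insert a t)
    t⁺-chain = chain-insert (chain-lower a≼v (chain t-flag)) ≼-refl (≼-trans a≼v (Atom.under v-atom))
                            (≼⇒∼ ∘ ≼-trans a≼v ∘ above (chain t-flag))

    t⁺-maximal : ∀ {s} → IsChain a b s → insert a t ⊆ₛ s → s ⊆ₛ insert a t
    t⁺-maximal {s} s-chain t⁺⊆s {x} x∈s with x ≟ a
    ... | yes refl = ∈-insert-self a t
    ... | no x≢a   = ∈-insert⁺ a (maximal t-flag s⁻-chain t⊆s⁻ (∈-delete⁺ a x≢a x∈s))
      where
      s⁻-chain : IsChain v b (delete a s)
      s⁻-chain = record
        { above  = λ y∈ → let y≢a , y∈s = ∈-delete⁻ a s y∈ in
                   atom-≼ v-atom (≼∧≢⇒≺ (above s-chain y∈s) (y≢a ∘ sym))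
                                 (linear s-chain y∈s (t⁺⊆s (∈-insert⁺ a v∈t)))
        ; below  = below s-chain ∘ proj₂ ∘ ∈-delete⁻ a s
        ; linear = λ y∈ z∈ → linear s-chain (proj₂ (∈-delete⁻ a s y∈)) (proj₂ (∈-delete⁻ a s z∈))
        }
      t⊆s⁻ : t ⊆ₛ delete a s
      t⊆s⁻ {y} y∈t = ∈-delete⁺ a (λ { refl → a∉t y∈t }) (t⁺⊆s (∈-insert⁺ a y∈t))

  -- The atom is the lowest face of the flag; its rank is forced by the maximality of the flag.
  flag-drop : ∀ {a b t} → a ≺ b → ¬ a ∈ₛ t → IsFlag a b (insert a t) → ∃ λ w → Atom a b w × IsFlag w b t
  flag-drop {a} {b} {t} a≺b a∉t t⁺-flag
    with minimal-member (∈-insert⁻-≢ a t (≺⇒≢ a≺b ∘ sym) (flag-top t⁺-flag (≺⇒≼ a≺b)))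
  ... | w , w∈t , w-minimal =
    w , record { over = a≼w ; under = w≼b ; covers = rk-w } , record { chain = t-chain ; maximal = t-maximal }
    where
    t⁺-chain = chain t⁺-flag
    a≼w = above t⁺-chain (∈-insert⁺ a w∈t)
    w≼b = below t⁺-chain (∈-insert⁺ a w∈t)
    a≺w = ≼∧≢⇒≺ a≼w λ { refl → a∉t w∈t }

    w≼t : ∀ {x} → x ∈ₛ t → w ≼ x
    w≼t x∈t = ∼∧rk≤⇒≼ (linear t⁺-chain (∈-insert⁺ a w∈t) (∈-insert⁺ a x∈t)) (w-minimal x∈t)

    between-in-flag : ∀ {c} → a ≼ c → c ≼ w → c ∈ₛ insert a t
    between-in-flag {c} a≼c c≼w = flag-member t⁺-flag a≼c (≼-trans c≼w w≼b) λ y∈ →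
      [ (λ { refl → ≽⇒∼ a≼c }) , ≼⇒∼ ∘ ≼-trans c≼w ∘ w≼t ] (∈-insert⁻ a t y∈)

    rk-w : rk w ≡ suc (rk a)
    rk-w = ℕ.≤-antisym (ℕ.≮⇒≥ no-face-between) (≺⇒rk< a≺w)
      where
      no-face-between : ¬ suc (rk a) < rk w
      no-face-between 1+rka<rkw with face-between a≼w (ℕ.n≤1+n (rk a)) (ℕ.<⇒≤ 1+rka<rkw)
      ... | c , a≼c , c≼w , rkc≡1+rka =
        ℕ.<⇒≱ 1+rka<rkw
              (subst (rk w ≤_) rkc≡1+rka (w-minimal (∈-insert⁻-≢ a t c≢a (between-in-flag a≼c c≼w))))
        where
        c≢a = λ { refl → ℕ.<-irrefl rkc≡1+rka (ℕ.n<1+n (rk a)) }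

    t-chain : IsChain w b t
    t-chain = record
      { above = w≼t ; below = below t⁺-chain ∘ ∈-insert⁺ a
      ; linear = λ x∈t y∈t → linear t⁺-chain (∈-insert⁺ a x∈t) (∈-insert⁺ a y∈t) }

    t-maximal : ∀ {s} → IsChain w b s → t ⊆ₛ s → s ⊆ₛ t
    t-maximal {s} s-chain t⊆s {x} x∈s =
      ∈-insert⁻-≢ a t (≺⇒≢ (≺-≼-trans a≺w (above s-chain x∈s)) ∘ sym)
                      (maximal t⁺-flag s⁺-chain t⁺⊆s⁺ (∈-insert⁺ a x∈s))
      where
      s⁺-chain : IsChain a b (insert a s)
      s⁺-chain = chain-insert (chain-lower a≼w s-chain) ≼-refl (≼-trans a≼w w≼b)
                              (≼⇒∼ ∘ ≼-trans a≼w ∘ above s-chain)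
      t⁺⊆s⁺ : insert a t ⊆ₛ insert a s
      t⁺⊆s⁺ y∈ = [ (λ { refl → ∈-insert-self a s }) , ∈-insert⁺ a ∘ t⊆s ] (∈-insert⁻ a t y∈)

  -- Removing a from a flag of b/a leaves a flag of b/v for exactly one atom v.
  numFlags-by-atoms : ∀ {a b} → a ≺ b → numFlags a b ≡ sumᵇ (atomᵇ a b) (λ v → numFlags v b) faces
  numFlags-by-atoms {a} {b} a≺b = begin
    numFlags a b                                  ≡⟨ countᵇ-allSubsets-insert a (isFlag a b) (λ {f} → contains-a {f}) ⟩
    countᵇ drops subsets                          ≡⟨ countᵇ-by-partners R drops faces subsets partners ⟩
    sum (map (λ v → countᵇ (R v) subsets) faces)  ≡⟨ cong sum (map-cong atom-term faces) ⟩
    sumᵇ (atomᵇ a b) (λ v → numFlags v b) faces   ∎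
    where
    open ≡-Reasoning
    subsets = allSubsets N

    drops : Subset → Bool
    drops t = not (lookup t a) ∧ isFlag a b (insert a t)

    R : Fin N → Subset → Bool
    R v t = atomᵇ a b v ∧ isFlag v b t

    contains-a : ∀ {f} → T (isFlag a b f) → T (lookup f a)
    contains-a {f} h = isMember (flag-bottom (isFlag⇒IsFlag {a} {b} {f} h) (≺⇒≼ a≺b))

    unique-partner : ∀ {t} → T (not (lookup t a)) → T (isFlag a b (insert a t)) →
                     countᵇ (λ v → R v t) faces ≡ 1
    unique-partner {t} a∉t t⁺-flag =
      let v , v-atom , v-flag = flag-drop a≺b (not-elim a∉t ∘ isMember) (isFlag⇒IsFlag {a} {b} {insert a t} t⁺-flag)
      in countᵇ≡1 (allFin⁺ N) (∈-allFin v) (∧-intro (Atom⇒atomᵇ v-atom) (IsFlag⇒isFlag {v} {b} {t} v-flag))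
           λ {w} h → let w-atom , w-flag = ∧-elim {atomᵇ a b w} h
                     in flag-bottom-unique (isFlag⇒IsFlag {w} {b} {t} w-flag) v-flag
                                           (Atom.under (atomᵇ⇒Atom w-atom)) (Atom.under v-atom)

    partners : ∀ t → countᵇ (λ v → R v t) faces ≡ (if drops t then 1 else 0)
    partners t with drops t in drops-t
    ... | true  = let a∉t , t⁺-flag = ∧-elim {not (lookup t a)} (≡true⇒T drops-t)
                  in unique-partner {t} a∉t t⁺-flag
    ... | false = countᵇ-none {p = λ v → R v t} {faces} λ {v} _ h →
      let v-atom , v-flag = ∧-elim {atomᵇ a b v} h
          a∉t , t⁺-flag = flag-lift (atomᵇ⇒Atom v-atom) (isFlag⇒IsFlag {v} {b} {t} v-flag)
      in subst T drops-t (∧-intro (not-intro (a∉t ∘ member)) (IsFlag⇒isFlag {a} {b} {insert a t} t⁺-flag))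

    atom-term : ∀ v → countᵇ (R v) subsets ≡ (if atomᵇ a b v then numFlags v b else 0)
    atom-term v with atomᵇ a b v
    ... | true  = refl
    ... | false = countᵇ-none {p = λ _ → false} {subsets} λ _ ()

  -- Connectivity of the edge graph of a section, by induction on its rank from the connectivity of sections.
  module _ {a : Fin N} (S : Fin N → Set)
           (S-edge : ∀ {e v w} → rk e ≡ suc (suc (rk a)) → Atom a e v → Atom a e w → S v → S w) where

    private
      Linked : Fin N → Set
      Linked x = ∀ {v w} → Atom a x v → Atom a x w → S v → S w

      Marked : Fin N → Set
      Marked y = ∃ λ u → Atom a y u × S u

      walk : ∀ {x y z} → (∀ {y} → y ≺ x → a ≺ y → Linked y) →
             T (properSec a x y) → Path (properSec a x) comparable y z → Marked y → Marked z
      walk _ _ done marked = marked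
      walk {x} {y} linked-below y-proper (step {y = y′} y′-proper y∼y′ rest) (u , u-atom , Su) =
        walk linked-below y′-proper rest (move (∨-elim {y ≤ᵇ y′} y∼y′))
        where
        a≺y = proj₁ (∧-elim {a <ᵇ y} y-proper)
        y≺x = proj₂ (∧-elim {a <ᵇ y} y-proper)
        move : y ≼ y′ ⊎ y′ ≼ y → Marked y′
        move (inj₁ y≼y′) = u , atom-below u-atom (≼-trans (Atom.under u-atom) y≼y′) , Su
        move (inj₂ y′≼y) =
          let u′ , u′-atom = atom-exists (proj₁ (∧-elim {a <ᵇ y′} y′-proper))
          in u′ , u′-atom ,
             linked-below y≺x a≺y u-atom (atom-below u′-atom (≼-trans (Atom.under u′-atom) y′≼y)) Su

      atoms-linked : ∀ x → Acc _<_ (rk x) → a ≺ x → Linked x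
      atoms-linked x (acc smaller) a≺x {v} {w} v-atom w-atom Sv with ℕ.m≤n⇒m<n∨m≡n (≺⇒rk< a≺x)
      ... | inj₂ rkx≡ = subst S (trans (atom-≡ v-atom (sym rkx≡)) (sym (atom-≡ w-atom (sym rkx≡)))) Sv
      ... | inj₁ 1+rka<rkx with ℕ.m≤n⇒m<n∨m≡n 1+rka<rkx
      ...   | inj₂ rkx≡     = S-edge (sym rkx≡) v-atom w-atom Sv
      ...   | inj₁ 2+rka<rkx =
        let u , u-atom , Su = walk linked-below (proper v-atom) path (v , atom-below v-atom ≼-refl , Sv)
        in subst S (atom-≡ u-atom (Atom.covers w-atom)) Su
        where
        proper : ∀ {u} → Atom a x u → T (properSec a x u)
        proper u-atom = ∧-intro (Atom⇒≺ u-atom) (atom-≺ u-atom (ℕ.<⇒≤ 2+rka<rkx))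
        path : Path (properSec a x) comparable v w
        path = connected a x (≺⇒≼ a≺x) (subst (_≤ rk x) (ℕ.+-comm 3 (rk a)) 2+rka<rkx) v w
                         (proper v-atom) (proper w-atom)
        linked-below : ∀ {y} → y ≺ x → a ≺ y → Linked y
        linked-below y≺x = atoms-linked _ (smaller (≺⇒rk< y≺x))

    atoms-share : ∀ {b v w} → Atom a b v → Atom a b w → S v → S w
    atoms-share {b} v-atom =
      atoms-linked b (<-wellFounded (rk b)) (≺-≼-trans (Atom⇒≺ v-atom) (Atom.under v-atom)) v-atom

module Tightness (P : Polytope) (equivelar : Polytope.Equivelar P) where

  open import Data.Bool using (T)
  open import Data.Fin using (Fin; zero; suc; toℕ; fromℕ<)
  open import Data.Fin.Properties using (toℕ-fromℕ<; toℕ<n)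
  open import Data.List.Membership.Propositional.Properties using (∈-allFin)
  open import Data.Nat using (ℕ; zero; suc; _+_; _*_; _∸_; _≤_; _<_; s≤s; z≤n; >-nonZero)
  import Data.Nat.Properties as ℕ
  open import Algebra.Properties.CommutativeSemigroup ℕ.*-commutativeSemigroup using () renaming (x∙yz≈y∙xz to x*yz≡y*xz)
  open import Data.Product using (∃; _×_; _,_; proj₁; proj₂)
  open import Function using (_∘_)
  open import Relation.Binary.PropositionalEquality using (_≡_; refl; sym; trans; cong; cong₂; subst; module ≡-Reasoning)
  open import Relation.Nullary using (Dec; yes; no; contradiction)
  open Counting

  open Polytope P hiding (≤-refl; ≤-trans; ≤-antisym)
  open Faces P

  private
    d : ℕ
    d = secRank F₋₁ Fₙ ∸ 1

    type : Fin d → ℕ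
    type = proj₁ equivelar

  -- q j = p_(j+1) counts the vertices of the polygons y/x with rk x = j; outside j < n - 1 its value 0 is junk.
  q : ℕ → ℕ
  q j = from-dec (j ℕ.<? d)
    where
    from-dec : Dec (j < d) → ℕ
    from-dec (yes j<d) = type (fromℕ< j<d)
    from-dec (no _)    = 0

  q-type : ∀ {j} (j<d : j < d) → q j ≡ type (fromℕ< j<d)
  q-type {j} j<d with j ℕ.<? d
  ... | yes _  = refl
  ... | no j≮d = contradiction j<d j≮d

  3+m≤n⇒m<n∸1∸1 : ∀ {m n} → 3 + m ≤ n → m < n ∸ 1 ∸ 1
  3+m≤n⇒m<n∸1∸1 {n = suc (suc n)} (s≤s (s≤s 1+m≤n)) = 1+m≤n

  j<b∸a∸1∸1⇒3+a+j≤b : ∀ a b j → j < b ∸ a ∸ 1 ∸ 1 → 3 + (a + j) ≤ b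
  j<b∸a∸1∸1⇒3+a+j≤b zero    (suc (suc b)) j (s≤s j<b) = s≤s (s≤s (s≤s j<b))
  j<b∸a∸1∸1⇒3+a+j≤b (suc a) (suc b)       j j<b∸a∸2 =
    ℕ.≤-trans (ℕ.≤-reflexive (cong suc (sym (ℕ.+-suc 2 (a + j))))) (s≤s (j<b∸a∸1∸1⇒3+a+j≤b a b j j<b∸a∸2))

  q-polygon : ∀ {x y} → x ≼ y → rk y ≡ 3 + rk x → numVertices x y ≡ q (rk x)
  q-polygon {x} {y} x≼y rky≡3+rkx =
    trans (proj₂ equivelar j x y (in-P x) (in-P y) x≼y rkx≡ rky≡) (sym (q-type rkx<d))
    where
    rkx<d : rk x < d
    rkx<d = subst (λ r → rk x < rk Fₙ ∸ r ∸ 1 ∸ 1) (sym rk-least)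
                  (3+m≤n⇒m<n∸1∸1 (subst (_≤ rk Fₙ) rky≡3+rkx (≼⇒rk≤ (greatest y))))
    j = fromℕ< rkx<d
    in-P : ∀ z → T (inSec F₋₁ Fₙ z)
    in-P z = ∧-intro (least z) (greatest z)
    rkx≡ : rk x ≡ rk F₋₁ + toℕ j
    rkx≡ = sym (cong₂ _+_ rk-least (toℕ-fromℕ< rkx<d))
    rky≡ : rk y ≡ rk F₋₁ + toℕ j + 3
    rky≡ = trans rky≡3+rkx (trans (ℕ.+-comm 3 (rk x)) (cong (_+ 3) rkx≡))

  numAtoms-polygon : ∀ {x y} → x ≼ y → rk y ≡ 3 + rk x → numAtoms x y ≡ q (rk x)
  numAtoms-polygon {x} x≼y rky =
    trans (sym (numVertices≡numAtoms (subst (2 + rk x ≤_) (sym rky) (ℕ.n≤1+n _)))) (q-polygon x≼y rky)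

  q-pos : ∀ {a b j} → a ≼ b → rk a ≤ j → 3 + j ≤ rk b → 0 < q j
  q-pos a≼b rka≤j 3+j≤rkb with polygon-between a≼b rka≤j 3+j≤rkb
  ... | x , y , _ , x≼y , _ , refl , rky = subst (0 <_) (numAtoms-polygon x≼y rky) (numAtoms-pos (≼∧gap⇒≺ x≼y rky))

  ∏q : ℕ → ℕ → ℕ
  ∏q i zero    = 1
  ∏q i (suc l) = q i * ∏q (suc i) l

  ∏q-pos : ∀ {a b} i l → a ≼ b → rk a ≤ i → 2 + l + i ≤ rk b → 0 < ∏q i l
  ∏q-pos         i zero    _   _     _     = s≤s z≤n
  ∏q-pos {b = b} i (suc l) a≼b rka≤i bound =
    ℕ.*-mono-< (q-pos a≼b rka≤i (ℕ.≤-trans (s≤s (s≤s (s≤s (ℕ.m≤n+m i l)))) bound))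
               (∏q-pos (suc i) l a≼b (ℕ.m≤n⇒m≤1+n rka≤i)
                       (subst (_≤ rk b) (sym (cong (2 +_) (ℕ.+-suc l i))) bound))

  prodFin≡∏q : ∀ l i (f : Fin l → ℕ) → (∀ j → f j ≡ q (i + toℕ j)) → prodFin f ≡ ∏q i l
  prodFin≡∏q zero    i f f≡q = refl
  prodFin≡∏q (suc l) i f f≡q =
    cong₂ _*_ (trans (f≡q zero) (cong q (ℕ.+-identityʳ i)))
              (prodFin≡∏q l (suc i) (f ∘ suc) λ j → trans (f≡q (suc j)) (cong q (ℕ.+-suc i (toℕ j))))

  -- TightSec a b with the type of b/a read off from q, which an equivelar P determines.
  IsTight : Fin N → Fin N → Set
  IsTight a b = numFlags a b ≡ 2 * ∏q (rk a) (secRank a b ∸ 1)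

  secRank∸1 : ∀ {a b l} → rk b ≡ 2 + l + rk a → secRank a b ∸ 1 ≡ l
  secRank∸1 {a} {l = l} rkb rewrite rkb = cong (λ r → r ∸ 1 ∸ 1) (ℕ.m+n∸n≡m (2 + l) (rk a))

  IsTight⇒count : ∀ {a b l} → rk b ≡ 2 + l + rk a → IsTight a b → numFlags a b ≡ 2 * ∏q (rk a) l
  IsTight⇒count {a} rkb tight = trans tight (cong (λ l → 2 * ∏q (rk a) l) (secRank∸1 rkb))

  count⇒IsTight : ∀ {a b l} → rk b ≡ 2 + l + rk a → numFlags a b ≡ 2 * ∏q (rk a) l → IsTight a b
  count⇒IsTight {a} rkb count = trans count (cong (λ l → 2 * ∏q (rk a) l) (sym (secRank∸1 rkb)))

  IsTight⇒TightSec : ∀ {a b} → IsTight a b → TightSec a b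
  IsTight⇒TightSec {a} {b} tight =
    type′ , type′-polygons , trans tight (cong (2 *_) (sym (prodFin≡∏q _ (rk a) type′ λ _ → refl)))
    where
    type′ : Fin (secRank a b ∸ 1) → ℕ
    type′ j = q (rk a + toℕ j)
    type′-polygons : EquivelarSecOfType a b type′
    type′-polygons j x y _ _ x≼y rkx rky =
      trans (q-polygon x≼y (trans rky (trans (ℕ.+-comm _ 3) (cong (3 +_) (sym rkx))))) (cong q rkx)

  TightSec⇒IsTight : ∀ {a b} → a ≼ b → TightSec a b → IsTight a b
  TightSec⇒IsTight {a} {b} a≼b (type′ , type′-polygons , count) =
    trans count (cong (2 *_) (prodFin≡∏q _ (rk a) type′ type′≡q))
    where
    type′≡q : ∀ j → type′ j ≡ q (rk a + toℕ j)
    type′≡q j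
      with polygon-between a≼b (ℕ.m≤m+n (rk a) (toℕ j)) (j<b∸a∸1∸1⇒3+a+j≤b (rk a) (rk b) (toℕ j) (toℕ<n j))
    ... | x , y , a≼x , x≼y , y≼b , rkx , rky =
      trans (sym (type′-polygons j x y (∧-intro a≼x (≼-trans x≼y y≼b)) (∧-intro (≼-trans a≼x x≼y) y≼b) x≼y rkx
                                 (trans rky (trans (ℕ.+-comm 3 (rk x)) (cong (_+ 3) rkx)))))
            (trans (q-polygon x≼y rky) (cong q rkx))

  numAtoms-≥ : ∀ {a b} → a ≼ b → 3 + rk a ≤ rk b → q (rk a) ≤ numAtoms a b
  numAtoms-≥ {a} {b} a≼b 3+rka≤rkb with face-between a≼b (ℕ.m≤n+m (rk a) 3) 3+rka≤rkb
  ... | y , a≼y , y≼b , rky = subst (_≤ numAtoms a b) (numAtoms-polygon a≼y rky) (countᵇ-mono faces (atomᵇ-mono y≼b))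

  rank-gap : ∀ {r m} → 3 + r ≤ m → ∃ λ l → m ≡ 3 + l + r
  rank-gap {r} {m} 3+r≤m =
    l , trans (sym (ℕ.m∸n+n≡m 3+r≤m)) (trans (ℕ.+-comm l (3 + r)) (cong (3 +_) (ℕ.+-comm r l)))
    where l = m ∸ (3 + r)

  3+l+r≡2+l+[1+r] : ∀ l r → 3 + l + r ≡ 2 + l + suc r
  3+l+r≡2+l+[1+r] l r = cong (2 +_) (sym (ℕ.+-suc l r))

  rank-step : ∀ {a b v l} → Atom a b v → rk b ≡ 3 + l + rk a → rk b ≡ 2 + l + rk v
  rank-step {a} {l = l} v-atom rkb =
    trans rkb (trans (3+l+r≡2+l+[1+r] l (rk a)) (cong (2 + l +_) (sym (Atom.covers v-atom))))

  3+rka≤rkb : ∀ {a b l} → rk b ≡ 3 + l + rk a → 3 + rk a ≤ rk b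
  3+rka≤rkb {a} {l = l} rkb = subst (3 + rk a ≤_) (sym rkb) (s≤s (s≤s (s≤s (ℕ.m≤n+m (rk a) l))))

  numFlags-≥ : ∀ l {a b} → a ≼ b → rk b ≡ 2 + l + rk a → 2 * ∏q (rk a) l ≤ numFlags a b

  atom-numFlags-≥ : ∀ l {a b v} → rk b ≡ 3 + l + rk a → Atom a b v → 2 * ∏q (suc (rk a)) l ≤ numFlags v b
  atom-numFlags-≥ l {b = b} {v} rkb v-atom =
    subst (λ r → 2 * ∏q r l ≤ numFlags v b) (Atom.covers v-atom)
          (numFlags-≥ l (Atom.under v-atom) (rank-step v-atom rkb))

  numFlags-≥ zero {a} {b} a≼b rkb = begin
    2                                           ≡⟨ sym (numAtoms-edge a≼b rkb) ⟩
    numAtoms a b                                ≡⟨ sym (ℕ.*-identityʳ _) ⟩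
    numAtoms a b * 1                            ≤⟨ sumᵇ-≥ (atomᵇ a b) (λ v → numFlags v b) 1 faces
                                                          (λ {v} _ → numFlags-pos v b) ⟩
    sumᵇ (atomᵇ a b) (λ v → numFlags v b) faces ≡⟨ sym (numFlags-by-atoms (≼∧gap⇒≺ a≼b rkb)) ⟩
    numFlags a b                                ∎
    where open ℕ.≤-Reasoning
  numFlags-≥ (suc l) {a} {b} a≼b rkb = begin
    2 * (q (rk a) * L)                          ≡⟨ x*yz≡y*xz 2 (q (rk a)) _ ⟩
    q (rk a) * (2 * L)                          ≤⟨ ℕ.*-monoˡ-≤ _ (numAtoms-≥ a≼b (3+rka≤rkb rkb)) ⟩
    numAtoms a b * (2 * L)                      ≤⟨ sumᵇ-≥ (atomᵇ a b) (λ v → numFlags v b) _ faces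
                                                          (atom-numFlags-≥ l rkb ∘ atomᵇ⇒Atom) ⟩
    sumᵇ (atomᵇ a b) (λ v → numFlags v b) faces ≡⟨ sym (numFlags-by-atoms (≼∧gap⇒≺ a≼b rkb)) ⟩
    numFlags a b                                ∎
    where
    open ℕ.≤-Reasoning
    L = ∏q (suc (rk a)) l

  -- For a tight section both estimates in numFlags-≥ are equalities.
  tight-atoms : ∀ l {a b} → a ≼ b → rk b ≡ 3 + l + rk a → numFlags a b ≡ 2 * ∏q (rk a) (suc l) →
                numAtoms a b ≡ q (rk a) × (∀ {v} → Atom a b v → numFlags v b ≡ 2 * ∏q (suc (rk a)) l)
  tight-atoms l {a} {b} a≼b rkb tight = numAtoms≡q , atom-count
    where
    L = 2 * ∏q (suc (rk a)) l
    sum = sumᵇ (atomᵇ a b) (λ v → numFlags v b) faces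

    sum≡q*L : sum ≡ q (rk a) * L
    sum≡q*L = trans (sym (numFlags-by-atoms (≼∧gap⇒≺ a≼b rkb))) (trans tight (x*yz≡y*xz 2 (q (rk a)) _))

    sum≡numAtoms*L : sum ≡ numAtoms a b * L
    sum≡numAtoms*L = ℕ.≤-antisym
      (ℕ.≤-trans (ℕ.≤-reflexive sum≡q*L) (ℕ.*-monoˡ-≤ L (numAtoms-≥ a≼b (3+rka≤rkb rkb))))
      (sumᵇ-≥ (atomᵇ a b) (λ v → numFlags v b) L faces (atom-numFlags-≥ l rkb ∘ atomᵇ⇒Atom))

    atom-count : ∀ {v} → Atom a b v → numFlags v b ≡ L
    atom-count {v} v-atom = sumᵇ-≡⇒const (atomᵇ a b) (λ v → numFlags v b) L faces
      (atom-numFlags-≥ l rkb ∘ atomᵇ⇒Atom) sum≡numAtoms*L (∈-allFin v) (Atom⇒atomᵇ v-atom)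

    L-pos : 0 < L
    L-pos = ℕ.*-mono-< (ℕ.0<1+n {1}) (∏q-pos (suc (rk a)) l a≼b (ℕ.n≤1+n (rk a))
                                              (ℕ.≤-reflexive (sym (trans rkb (3+l+r≡2+l+[1+r] l (rk a))))))

    numAtoms≡q : numAtoms a b ≡ q (rk a)
    numAtoms≡q = ℕ.*-cancelʳ-≡ _ _ L {{>-nonZero L-pos}} (trans (sym sum≡numAtoms*L) sum≡q*L)

  tight⇒atom-tight : ∀ {a b v} → 3 + rk a ≤ rk b → IsTight a b → Atom a b v → IsTight v b
  tight⇒atom-tight {a} {b} {v} 3+rka≤rkb tight v-atom with rank-gap 3+rka≤rkb
  ... | l , rkb = count⇒IsTight (rank-step v-atom rkb)
    (trans (proj₂ (tight-atoms l a≼b rkb (IsTight⇒count rkb tight)) v-atom)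
           (cong (λ r → 2 * ∏q r l) (sym (Atom.covers v-atom))))
    where a≼b = ≼-trans (Atom.over v-atom) (Atom.under v-atom)

  tight⇒atom≼polygon : ∀ {a b v y} → 3 + rk a ≤ rk b → IsTight a b → Atom a b v →
                       a ≼ y → y ≼ b → rk y ≡ 3 + rk a → v ≼ y
  tight⇒atom≼polygon {a} {b} {v} {y} 3+rka≤rkb tight v-atom a≼y y≼b rky with rank-gap 3+rka≤rkb
  ... | l , rkb =
    Atom.under (atomᵇ⇒Atom (countᵇ-≡⇒⊇ faces (atomᵇ-mono y≼b) same-count (∈-allFin v) (Atom⇒atomᵇ v-atom)))
    where
    a≼b = ≼-trans (Atom.over v-atom) (Atom.under v-atom)
    same-count : numAtoms a y ≡ numAtoms a b
    same-count = trans (numAtoms-polygon a≼y rky) (sym (proj₁ (tight-atoms l a≼b rkb (IsTight⇒count rkb tight))))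

  -- Tightness of Fₙ/v puts every edge at an atom v ≼ y₀ into G, and tightness of F/a then puts the
  -- other atom of the edge below y₀; by connectivity of the edge graph, every atom of Fₙ/a lies below y₀.
  atoms-below-polygon : ∀ {a y₀ G F} → a ≼ y₀ → rk y₀ ≡ 3 + rk a → y₀ ≼ G → rk G ≡ suc (rk y₀) → G ≼ F →
                        IsTight a F → (∀ {v} → Atom a Fₙ v → IsTight v Fₙ) → ∀ {v} → Atom a Fₙ v → v ≼ y₀
  atoms-below-polygon {a} {y₀} {G} {F} a≼y₀ rky₀ y₀≼G rkG G≼F F-tight atoms-tight v-atom
    with atom-exists (≼∧gap⇒≺ a≼y₀ rky₀)
  ... | u₀ , u₀-atom = atoms-share (_≼ y₀) edge (atom-below u₀-atom (greatest u₀)) v-atom (Atom.under u₀-atom)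
    where
    edge : ∀ {e v w} → rk e ≡ suc (suc (rk a)) → Atom a e v → Atom a e w → v ≼ y₀ → w ≼ y₀
    edge {e} {v} {w} rke v-atom w-atom v≼y₀ =
      tight⇒atom≼polygon 3+rka≤rkF F-tight (atom-below w-atom (≼-trans (Atom.under w-atom) (≼-trans e≼G G≼F)))
                         a≼y₀ (≼-trans y₀≼G G≼F) rky₀
      where
      rkG≡3+rkv : rk G ≡ 3 + rk v
      rkG≡3+rkv = trans rkG (trans (cong suc rky₀) (cong (3 +_) (sym (Atom.covers v-atom))))
      3+rka≤rkF : 3 + rk a ≤ rk F
      3+rka≤rkF = ℕ.≤-trans (ℕ.n≤1+n _) (subst (_≤ rk F) (trans rkG (cong suc rky₀)) (≼⇒rk≤ G≼F))
      e-over-v : Atom v Fₙ e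
      e-over-v = record { over = Atom.under v-atom ; under = greatest e
                        ; covers = trans rke (cong suc (sym (Atom.covers v-atom))) }
      e≼G : e ≼ G
      e≼G = tight⇒atom≼polygon (subst (_≤ rk Fₙ) rkG≡3+rkv (≼⇒rk≤ (greatest G)))
                               (atoms-tight (atom-below v-atom (greatest v)))
                               e-over-v (≼-trans v≼y₀ y₀≼G) (greatest G) rkG≡3+rkv

  numAtoms-Fₙ : ∀ {a M} → 4 + rk a ≤ M → M ≤ rk Fₙ →
                (∀ {F} → rk F ≡ M → a ≼ F → IsTight a F) → (∀ {v} → Atom a Fₙ v → IsTight v Fₙ) →
                numAtoms a Fₙ ≡ q (rk a)
  numAtoms-Fₙ {a} {M} 4+rka≤M M≤rkFₙ M-faces-tight atoms-tight
    with face-between (greatest a) (ℕ.m≤n+m (rk a) 3) (ℕ.≤-trans (ℕ.n≤1+n _) (ℕ.≤-trans 4+rka≤M M≤rkFₙ))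
  ... | y₀ , a≼y₀ , _ , rky₀
    with face-between (greatest y₀) (ℕ.n≤1+n (rk y₀))
                      (subst (λ r → suc r ≤ rk Fₙ) (sym rky₀) (ℕ.≤-trans 4+rka≤M M≤rkFₙ))
  ... | G , y₀≼G , _ , rkG
    with face-between (greatest G) (subst (_≤ M) (sym (trans rkG (cong suc rky₀))) 4+rka≤M) M≤rkFₙ
  ... | F , G≼F , _ , rkF = begin
    numAtoms a Fₙ ≡⟨ countᵇ-cong faces (Atom⇒atomᵇ ∘ below-y₀ ∘ atomᵇ⇒Atom) (atomᵇ-mono (greatest y₀)) ⟩
    numAtoms a y₀ ≡⟨ numAtoms-polygon a≼y₀ rky₀ ⟩
    q (rk a)      ∎
    where
    open ≡-Reasoning
    below-y₀ : ∀ {v} → Atom a Fₙ v → Atom a y₀ v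
    below-y₀ v-atom = atom-below v-atom (atoms-below-polygon a≼y₀ rky₀ y₀≼G rkG G≼F
                                           (M-faces-tight rkF (≼-trans a≼y₀ (≼-trans y₀≼G G≼F))) atoms-tight v-atom)

  module _ {K M : ℕ} (K+3≤M : K + 3 ≤ M) (M≤rkFₙ : M ≤ rk Fₙ)
           (co-K-faces-tight : ∀ {G} → rk G ≡ K → IsTight G Fₙ) where

    co-face-tight : ∀ d {a} → d + rk a ≡ K → (∀ {F} → rk F ≡ M → a ≼ F → IsTight a F) → IsTight a Fₙ
    co-face-tight zero    rka≡K _ = co-K-faces-tight rka≡K
    co-face-tight (suc d) {a} 1+d+rka≡K M-faces-tight = count⇒IsTight rkFₙ (begin
      numFlags a Fₙ
        ≡⟨ numFlags-by-atoms (≼∧gap⇒≺ (greatest a) rkFₙ) ⟩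
      sumᵇ (atomᵇ a Fₙ) (λ v → numFlags v Fₙ) faces
        ≡⟨ sumᵇ-const (atomᵇ a Fₙ) (λ v → numFlags v Fₙ) L faces (atom-count ∘ atomᵇ⇒Atom) ⟩
      numAtoms a Fₙ * L
        ≡⟨ cong (_* L) (numAtoms-Fₙ 4+rka≤M M≤rkFₙ M-faces-tight atom-co-face-tight) ⟩
      q (rk a) * L
        ≡⟨ sym (x*yz≡y*xz 2 (q (rk a)) _) ⟩
      2 * ∏q (rk a) (suc l)
        ∎)
      where
      open ≡-Reasoning
      4+rka≤M : 4 + rk a ≤ M
      4+rka≤M = ℕ.≤-trans (ℕ.+-monoʳ-≤ 3 (subst (suc (rk a) ≤_) 1+d+rka≡K (s≤s (ℕ.m≤n+m (rk a) d))))
                          (subst (_≤ M) (ℕ.+-comm K 3) K+3≤M)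
      gap = rank-gap (ℕ.≤-trans (ℕ.n≤1+n _) (ℕ.≤-trans 4+rka≤M M≤rkFₙ))
      l = proj₁ gap
      rkFₙ = proj₂ gap
      L = 2 * ∏q (suc (rk a)) l

      atom-co-face-tight : ∀ {v} → Atom a Fₙ v → IsTight v Fₙ
      atom-co-face-tight {v} v-atom =
        co-face-tight d (trans (cong (d +_) (Atom.covers v-atom)) (trans (ℕ.+-suc d (rk a)) 1+d+rka≡K))
          λ {F} rkF v≼F → tight⇒atom-tight (subst (3 + rk a ≤_) (sym rkF) (ℕ.≤-trans (ℕ.n≤1+n _) 4+rka≤M))
                                           (M-faces-tight rkF (≼-trans (Atom.over v-atom) v≼F)) (atom-below v-atom v≼F)

      atom-count : ∀ {v} → Atom a Fₙ v → numFlags v Fₙ ≡ L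
      atom-count {v} v-atom = trans (IsTight⇒count (rank-step v-atom rkFₙ) (atom-co-face-tight v-atom))
                                    (cong (λ r → 2 * ∏q r l) (Atom.covers v-atom))

    polytope-tight : (∀ {F} → rk F ≡ M → IsTight F₋₁ F) → IsTight F₋₁ Fₙ
    polytope-tight M-faces-tight =
      co-face-tight K (trans (cong (K +_) rk-least) (ℕ.+-identityʳ K)) (λ rkF _ → M-faces-tight rkF)

open import Data.Fin using (Fin)
open import Data.Integer using (ℤ; +_; -1ℤ; _+_; _≤_)
open import Relation.Binary.PropositionalEquality using (_≡_)
open import Data.Integer using (_-_; +≤+; -≤-; -[1+_])
open import Data.Nat using (ℕ; suc; s≤s)
import Data.Nat as ℕ
open import Data.Product using (∃₂; _×_; _,_)
open import Relation.Binary.PropositionalEquality using (refl; cong; subst; sym)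

-- K and M are the values of rk = rank + 1 on k-faces and m-faces.
rk-bounds : ∀ {k m n} → -1ℤ ≤ k → k + + 3 ≤ m → m ≤ + n →
            ∃₂ λ K M → k ≡ + K - + 1 × m ≡ + M - + 1 × K ℕ.+ 3 ℕ.≤ M × M ℕ.≤ suc n
rk-bounds {+ k}         {+ m} _ (+≤+ k+3≤m) (+≤+ m≤n) = suc k , suc m , refl , refl , s≤s k+3≤m , s≤s m≤n
rk-bounds { -[1+ 0 ] } {+ m} _ (+≤+ 2≤m)   (+≤+ m≤n) = 0 , suc m , refl , refl , s≤s 2≤m , s≤s m≤n
rk-bounds { -[1+ suc _ ] } (-≤- ())

proposition4p6 : (P : Polytope) → Polytope.Equivelar P →
    (k m : ℤ) → -1ℤ ≤ k → k + + 3 ≤ m → m ≤ + (Polytope.n P) →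
    (∀ (F : Fin (Polytope.N P)) → Polytope.rank P F ≡ m → Polytope.TightSec P (Polytope.F₋₁ P) F) →
    (∀ (G : Fin (Polytope.N P)) → Polytope.rank P G ≡ k → Polytope.TightSec P G (Polytope.Fₙ P)) →
    Polytope.Tight P
proposition4p6 P equivelar k m -1≤k k+3≤m m≤n m-faces-tight co-k-faces-tight
  with rk-bounds -1≤k k+3≤m m≤n
... | K , M , refl , refl , K+3≤M , M≤1+n =
  IsTight⇒TightSec (polytope-tight K+3≤M (subst (M ℕ.≤_) (sym rk-greatest) M≤1+n)
    (λ {G} rkG → TightSec⇒IsTight (greatest G) (co-k-faces-tight G (cong (λ r → + r - + 1) rkG)))
    (λ {F} rkF → TightSec⇒IsTight (least F) (m-faces-tight F (cong (λ r → + r - + 1) rkF))))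
  where
  open Polytope P
  open Faces P
  open Tightness P equivelar
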